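{- Let $G$ be a chordal graph or a graph in $\mathcal{G}_{m,n}$ for some $m,n \in \mathbb{N}\cup\{0\}$. Then the independence complex $\mathcal{I}(G)$ admits an acyclic matching $\mathcal{V}$ such that all $\mathcal{V}$-critical simplices, except possibly one $0$-dimensional simplex, are maximal simplices of $\mathcal{I}(G)$.
   Context: Graphs are finite, simple and undirected. A graph is chordal if it has no induced cycle of length at least $4$. For $m,n \in \mathbb{N}\cup\{0\}$, $\mathcal{G}_{m,n}$ is the class of graphs whose vertex set is a disjoint union $V = \bigsqcup_{i=0}^{m}\bigsqcup_{j=0}^{n} V_{i,j}$ with each $V_{i,j}\neq\emptyset$, where distinct vertices $x \in V_{i_1,j_1}$ and $y \in V_{i_2,j_2}$ are adjacent if and only if ($i_1 \le i_2$ and $j_1 \le j_2$) or ($i_1 \ge i_2$ and $j_1 \ge j_2$). The independence complex $\mathcal{I}(G)$ is the simplicial complex of all independent sets of $G$ (including $\emptyset$). An acyclic matching on a simplicial complex $\mathcal{X}$ is a set $\mathcal{V}$ of pairs $(\alpha,\beta)$ of simplices with $\alpha \subseteq \beta$, $\dim\beta=\dim\alpha+1$ (the empty simplex allowed, of dimension $-1$), each simplex in at most one pair, such that reversing the edges of $\mathcal{V}$ in the directed Hasse diagram of $\mathcal{X}$ (edges $\beta\to\alpha$ for codimension-one faces) yields no directed cycle. A non-empty simplex is $\mathcal{V}$-critical if it is unpaired in $\mathcal{V}$ or paired with $\emptyset$. -}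

module Defs where

open import Data.Bool using (Bool; true; false)
open import Data.Nat as ℕ using (ℕ; zero; suc)
open import Data.Fin as Fin using (Fin; toℕ)
open import Data.Fin.Subset using (Subset; _∈_; _⊆_; ∣_∣; ⁅_⁆; ⊥)
open import Data.Product using (Σ; _×_; _,_; ∃; ∃-syntax)
open import Data.Sum using (_⊎_)
open import Data.Maybe using (Maybe; just)
open import Data.List using (List; length; lookup)
open import Data.List.Membership.Propositional using () renaming (_∈_ to _∈ₗ_)
open import Function.Definitions using (Injective)
open import Relation.Binary.PropositionalEquality using (_≡_)
open import Relation.Binary.Construct.Closure.Transitive using (TransClosure)
open import Relation.Nullary using (¬_)

record Graph : Set where
  field
    size   : ℕ
    adj    : Fin size → Fin size → Bool
    adj-sym    : ∀ x y → adj x y ≡ adj y x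
    adj-irrefl : ∀ x → adj x x ≡ false
open Graph public

CycAdj : (k : ℕ) → Fin k → Fin k → Set
CycAdj k i j = (suc (toℕ i) ≡ toℕ j) ⊎ (suc (toℕ j) ≡ toℕ i)
             ⊎ ((toℕ i ≡ 0 × suc (toℕ j) ≡ k) ⊎ (toℕ j ≡ 0 × suc (toℕ i) ≡ k))

IsInducedCycle : (G : Graph) (k : ℕ) → (Fin k → Fin (size G)) → Set
IsInducedCycle G k f =
  Injective _≡_ _≡_ f × (∀ i j → (adj G (f i) (f j) ≡ true → CycAdj k i j)
                               × (CycAdj k i j → adj G (f i) (f j) ≡ true))

Chordal : Graph → Set
Chordal G = ∀ k → 4 ℕ.≤ k → (f : Fin k → Fin (size G)) → ¬ IsInducedCycle G k f

-- The class 𝒢_{m,n}: a labelling of vertices by (i,j) ∈ {0..m}×{0..n},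
-- every part V_{i,j} nonempty, adjacency as prescribed.

InClassG : ℕ → ℕ → Graph → Set
InClassG m n G =
  Σ (Fin (size G) → Fin (suc m)) λ ℓ₁ →
  Σ (Fin (size G) → Fin (suc n)) λ ℓ₂ →
    (∀ i j → ∃[ x ] (ℓ₁ x ≡ i × ℓ₂ x ≡ j))
  × (∀ x y → ¬ x ≡ y →
       (adj G x y ≡ true →
          (ℓ₁ x Fin.≤ ℓ₁ y × ℓ₂ x Fin.≤ ℓ₂ y) ⊎ (ℓ₁ y Fin.≤ ℓ₁ x × ℓ₂ y Fin.≤ ℓ₂ x))
     × ((ℓ₁ x Fin.≤ ℓ₁ y × ℓ₂ x Fin.≤ ℓ₂ y) ⊎ (ℓ₁ y Fin.≤ ℓ₁ x × ℓ₂ y Fin.≤ ℓ₂ x) →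
          adj G x y ≡ true))

-- Independence complex: simplices are independent vertex subsets
-- (the empty set included; the empty simplex has dimension -1).

Independent : (G : Graph) → Subset (size G) → Set
Independent G s = ∀ x y → x ∈ s → y ∈ s → adj G x y ≡ false

MaximalSimplex : (G : Graph) → Subset (size G) → Set
MaximalSimplex G s = Independent G s × (∀ t → Independent G t → s ⊆ t → t ≡ s)

CodimOneFace : ∀ {N} → Subset N → Subset N → Set
CodimOneFace τ σ = τ ⊆ σ × ∣ σ ∣ ≡ suc ∣ τ ∣

Matching : Graph → Set
Matching G = List (Subset (size G) × Subset (size G))

InPair : ∀ {N} → Subset N → Subset N × Subset N → Set
InPair σ (α , β) = σ ≡ α ⊎ σ ≡ β

-- Edges of the Hasse diagram of 𝓘(G) with the edges of M reversed:
-- β → α for codim-one faces α ⊂ β with (α,β) ∉ M, and α → β for (α,β) ∈ M.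
ModEdge : (G : Graph) → Matching G → Subset (size G) → Subset (size G) → Set
ModEdge G M σ τ =
  Independent G σ × Independent G τ ×
  ((CodimOneFace τ σ × ¬ ((τ , σ) ∈ₗ M)) ⊎ ((σ , τ) ∈ₗ M))

IsAcyclicMatching : (G : Graph) → Matching G → Set
IsAcyclicMatching G M =
    (∀ α β → (α , β) ∈ₗ M → Independent G α × Independent G β × CodimOneFace α β)
  × (∀ (i j : Fin (length M)) σ → InPair σ (lookup M i) → InPair σ (lookup M j) → i ≡ j)
  × (∀ σ → ¬ TransClosure (ModEdge G M) σ σ)

Paired : (G : Graph) → Matching G → Subset (size G) → Set
Paired G M σ = ∃[ p ] (p ∈ₗ M × InPair σ p)

Critical : (G : Graph) → Matching G → Subset (size G) → Set
Critical G M σ =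
  Independent G σ × ¬ σ ≡ ⊥ × (¬ Paired G M σ ⊎ (⊥ , σ) ∈ₗ M ⊎ (σ , ⊥) ∈ₗ M)

-- Choose, in the set T of still available vertices, a simplicial vertex v of G[T]: by Dirac's
-- lemma when G is chordal, and the corner of the remaining grid region when G ∈ 𝒢_{m,n}.  A
-- simplex σ drives a walk from T = V: if σ contains neighbours of v in T, take the least one u,
-- delete u, its neighbours and the neighbours of v below u from T, and repeat; otherwise v is the
-- pivot of σ.  Pair σ with σ ∪ {pivot} whenever the pivot lies outside σ and both are
-- independent.  Changing σ at its pivot does not change the walk, so this is a matching, and the
-- recorded choices of u followed by a size count decrease lexicographically along every edge of
-- the modified Hasse diagram, so it is acyclic.  An unmatched σ is maximal: without a pivot every
-- vertex outside σ was deleted next to some u ∈ σ and so has a neighbour in σ, while a pivot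
-- outside σ, being simplicial when chosen, has no neighbour in σ and could be added.  Only the
-- singleton of the pivot of ∅ is matched with ∅.

module Submission where

open import Defs
open import Data.Nat using (ℕ)
open import Data.Fin using (Fin)
open import Data.Fin.Subset using (⁅_⁆)
open import Data.Product using (Σ; _×_; ∃-syntax)
open import Data.Sum using (_⊎_)
open import Data.Maybe using (Maybe; just)
open import Relation.Binary.PropositionalEquality using (_≡_)

open import Data.Bool as Bool using (true; false; if_then_else_)
open import Data.Bool.Properties using (¬-not)
open import Data.Fin as Fin using (zero; suc; toℕ; fromℕ<)
import Data.Fin.Properties as Finₚ
open import Data.Fin.Subset
  using (Subset; inside; outside; _∈_; _∉_; _⊆_; _⊂_; _∪_; _-_; ∣_∣; ⊤; ⊥)
open import Data.Fin.Subset.Properties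
open import Data.List as List using (List; []; _∷_; _++_; cartesianProductWith)
open import Data.List.Membership.Propositional using () renaming (_∈_ to _∈ₗ_)
open import Data.List.Membership.Propositional.Properties
  using (∈-cartesianProductWith⁺; ∈-lookup; ∈-map⁺; ∈-map⁻; ∈-filter⁺; ∈-filter⁻)
open import Data.List.Relation.Binary.Lex.Strict as Lex using (Lex-<; next; this)
import Data.List.Relation.Binary.Pointwise as Pointwise
import Data.List.Relation.Unary.All as All
open import Data.List.Relation.Unary.All using ([]; _∷_)
open import Data.List.Relation.Unary.AllPairs using ([]; _∷_)
open import Data.List.Relation.Unary.Any using (here; there)
open import Data.List.Relation.Unary.Unique.Propositional using (Unique)
import Data.List.Relation.Unary.Unique.Propositional.Properties as Uniqueₚ
open import Data.Maybe as Maybe using (nothing; maybe′)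
open import Data.Maybe.Properties using (just-injective)
open import Data.Nat as ℕ using (zero; suc; _+_; _∸_; _≤_; _<_; _≤?_; _<?_; z≤n; s≤s)
open import Data.Nat.GeneralisedArithmetic using (fold)
import Data.Nat.Properties as ℕₚ
open import Data.Product using (_,_; proj₁; proj₂; ∃; ∃₂; map₁)
import Data.Sum as Sum
open import Data.Sum using (inj₁; inj₂; [_,_])
open import Data.Unit using (tt) renaming (⊤ to Unit)
open import Data.Vec using (tabulate)
  renaming (_∷_ to _∷ᵥ_; [] to []ᵥ; here to hereᵥ; there to thereᵥ)
open import Data.Vec.Properties using (lookup∘tabulate; []=⇒lookup; lookup⇒[]=; ∷-injective)
open import Function using (_∘_; id; _⇔_; mk⇔; case_of_)
open import Level using (0ℓ)
open import Relation.Binary using (tri<; tri≈; tri>)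
open import Relation.Binary.Construct.Closure.Transitive
  using (TransClosure; _∷_) renaming ([_] to [_]⁺)
open import Relation.Binary.PropositionalEquality hiding ([_])
open import Relation.Nullary
  using (¬_; ¬?; Dec; yes; no; does; contradiction; _×-dec_; _⊎-dec_; _→-dec_)
import Relation.Nullary.Decidable as Dec
open import Relation.Nullary.Decidable using (dec-true; dec-false; does-⇔; decidable-stable)
open import Relation.Unary using (Pred; Decidable)

private variable
  n : ℕ
  x y : Fin n
  p q : Subset n

true≢false : ∀ {b} → b ≡ true → b ≢ false
true≢false refl ()

module _ (P : Pred (Fin n) 0ℓ) where

  data Least : Maybe (Fin n) → Set where
    none : (∀ x → ¬ P x) → Least nothing
    some : ∀ {u} → P u → (∀ {x} → P x → u Fin.≤ x) → Least (just u)

module _ {P : Pred (Fin n) 0ℓ} where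

  Least-unique : ∀ {m m′} → Least P m → Least P m′ → m ≡ m′
  Least-unique (none _)      (none _)      = refl
  Least-unique (none ¬P)     (some Pu′ _)  = contradiction Pu′ (¬P _)
  Least-unique (some Pu _)   (none ¬P)     = contradiction Pu (¬P _)
  Least-unique (some Pu min) (some Pu′ min′) = cong just (Finₚ.≤-antisym (min Pu′) (min′ Pu))

least : ∀ {n} {P : Pred (Fin n) 0ℓ} → Decidable P → Maybe (Fin n)
least {ℕ.zero}  P? = nothing
least {ℕ.suc n} P? with P? zero
... | yes _ = just zero
... | no  _ = Maybe.map suc (least (P? ∘ suc))

least-spec : ∀ {n} {P : Pred (Fin n) 0ℓ} (P? : Decidable P) → Least P (least P?)
least-spec {ℕ.zero}  P? = none λ ()
least-spec {ℕ.suc n} P? with P? zero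
... | yes P0 = some P0 (λ _ → z≤n)
... | no ¬P0 with least (P? ∘ suc) | least-spec (P? ∘ suc)
...   | nothing | none ¬P     = none λ { zero → ¬P0 ; (suc x) → ¬P x }
...   | just u  | some Pu min =
  some Pu λ { {zero} P0 → contradiction P0 ¬P0 ; {suc x} Px → s≤s (min Px) }

least-≡ : ∀ {n} {P : Pred (Fin n) 0ℓ} (P? : Decidable P) {m} → Least P m → least P? ≡ m
least-≡ P? = Least-unique (least-spec P?)

⟦_⟧ : ∀ {n} {P : Pred (Fin n) 0ℓ} → Decidable P → Subset n
⟦ P? ⟧ = tabulate (does ∘ P?)

module _ {P : Pred (Fin n) 0ℓ} {P? : Decidable P} where

  ∈⟦⟧⁺ : P x → x ∈ ⟦ P? ⟧
  ∈⟦⟧⁺ {x} Px = lookup⇒[]= x _ (trans (lookup∘tabulate _ x) (dec-true (P? x) Px))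

  ∈⟦⟧⁻ : x ∈ ⟦ P? ⟧ → P x
  ∈⟦⟧⁻ {x} x∈ with P? x | trans (sym (lookup∘tabulate (does ∘ P?) x)) ([]=⇒lookup x∈)
  ... | yes Px | _  = Px
  ... | no _   | ()

x∈p-y⇒x≢y : x ∈ p - y → x ≢ y
x∈p-y⇒x≢y {x = x} {p} {y} x∈ refl = go p x x∈
  where
  go : ∀ {n} (p : Subset n) x → x ∉ p - x
  go (_ ∷ᵥ p) zero    ()
  go (_ ∷ᵥ p) (suc x) (thereᵥ x∈) = go p x x∈

x∈p-y⇒x∈p : x ∈ p - y → x ∈ p
x∈p-y⇒x∈p {p = p} {y} = p─q⊆p p ⁅ y ⁆

x∈p∪⁅y⁆⁻ : x ∈ p ∪ ⁅ y ⁆ → x ∈ p ⊎ x ≡ y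
x∈p∪⁅y⁆⁻ {p = p} {y} x∈ with x∈p∪q⁻ p ⁅ y ⁆ x∈
... | inj₁ x∈p  = inj₁ x∈p
... | inj₂ x∈⁅y⁆ = inj₂ (x∈⁅y⁆⇒x≡y y x∈⁅y⁆)

x∈p∪⁅x⁆ : ∀ (p : Subset n) x → x ∈ p ∪ ⁅ x ⁆
x∈p∪⁅x⁆ p x = x∈p∪q⁺ (inj₂ (x∈⁅x⁆ x))

x∉p⇒p-x≡p : x ∉ p → p - x ≡ p
x∉p⇒p-x≡p {x = x} {p} x∉p = ⊆-antisym x∈p-y⇒x∈p λ {y} y∈p →
  x∈p∧x≢y⇒x∈p-y y∈p λ { refl → x∉p y∈p }

[p∪⁅x⁆]-x≡p-x : ∀ (p : Subset n) x → (p ∪ ⁅ x ⁆) - x ≡ p - x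
[p∪⁅x⁆]-x≡p-x p x = ⊆-antisym
  (λ y∈ → x∈p∧x≢y⇒x∈p-y (drop-x (x∈p∪⁅y⁆⁻ (x∈p-y⇒x∈p y∈)) (x∈p-y⇒x≢y y∈)) (x∈p-y⇒x≢y y∈))
  (λ y∈ → x∈p∧x≢y⇒x∈p-y (x∈p∪q⁺ (inj₁ (x∈p-y⇒x∈p y∈))) (x∈p-y⇒x≢y y∈))
  where
  drop-x : ∀ {y} → y ∈ p ⊎ y ≡ x → y ≢ x → y ∈ p
  drop-x (inj₁ y∈p) _   = y∈p
  drop-x (inj₂ y≡x) y≢x = contradiction y≡x y≢x

x∈p⇒[p-x]∪⁅x⁆≡p : x ∈ p → (p - x) ∪ ⁅ x ⁆ ≡ p
x∈p⇒[p-x]∪⁅x⁆≡p {x = x} {p} x∈p = ⊆-antisym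
  (λ y∈ → [ x∈p-y⇒x∈p , (λ { refl → x∈p }) ] (x∈p∪⁅y⁆⁻ y∈))
  λ {y} y∈p → case y Finₚ.≟ x of λ where
    (yes refl) → x∈p∪⁅x⁆ (p - x) x
    (no y≢x)   → x∈p∪q⁺ (inj₁ (x∈p∧x≢y⇒x∈p-y y∈p y≢x))

x∉p⇒∣p∪⁅x⁆∣≡1+∣p∣ : x ∉ p → ∣ p ∪ ⁅ x ⁆ ∣ ≡ ℕ.suc ∣ p ∣
x∉p⇒∣p∪⁅x⁆∣≡1+∣p∣ {x = zero} {outside ∷ᵥ p} _ = cong ℕ.suc (cong ∣_∣ (∪-identityʳ p))
x∉p⇒∣p∪⁅x⁆∣≡1+∣p∣ {x = zero} {inside ∷ᵥ p} x∉p = contradiction hereᵥ x∉p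
x∉p⇒∣p∪⁅x⁆∣≡1+∣p∣ {x = suc x} {outside ∷ᵥ p} x∉p = x∉p⇒∣p∪⁅x⁆∣≡1+∣p∣ (x∉p ∘ thereᵥ)
x∉p⇒∣p∪⁅x⁆∣≡1+∣p∣ {x = suc x} {inside ∷ᵥ p} x∉p = cong ℕ.suc (x∉p⇒∣p∪⁅x⁆∣≡1+∣p∣ (x∉p ∘ thereᵥ))

x∈p⇒∣p∣≡1+∣p-x∣ : x ∈ p → ∣ p ∣ ≡ ℕ.suc ∣ p - x ∣
x∈p⇒∣p∣≡1+∣p-x∣ {x = x} {p} x∈p = begin
  ∣ p ∣                ≡⟨ cong ∣_∣ (x∈p⇒[p-x]∪⁅x⁆≡p x∈p) ⟨
  ∣ (p - x) ∪ ⁅ x ⁆ ∣  ≡⟨ x∉p⇒∣p∪⁅x⁆∣≡1+∣p∣ {p = p - x} (λ x∈ → x∈p-y⇒x≢y x∈ refl) ⟩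
  ℕ.suc ∣ p - x ∣      ∎
  where open ≡-Reasoning

⊆⇒≡⊎⊂ : p ⊆ q → p ≡ q ⊎ p ⊂ q
⊆⇒≡⊎⊂ {p = p} {q} p⊆q with Finₚ.any? (λ y → y ∈? q ×-dec ¬? (y ∈? p))
... | yes (y , y∈q , y∉p) = inj₂ (p⊆q , y , y∈q , y∉p)
... | no ∄ = inj₁ (⊆-antisym p⊆q λ {y} y∈q → decidable-stable (y ∈? p) λ y∉p → ∄ (y , y∈q , y∉p))

⊆∧∣∣≤⇒≡ : p ⊆ q → ∣ q ∣ ℕ.≤ ∣ p ∣ → p ≡ q
⊆∧∣∣≤⇒≡ p⊆q ∣q∣≤∣p∣ with ⊆⇒≡⊎⊂ p⊆q
... | inj₁ p≡q = p≡q
... | inj₂ p⊂q = contradiction ∣q∣≤∣p∣ (ℕₚ.<⇒≱ (p⊂q⇒∣p∣<∣q∣ p⊂q))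

codim-one-face : p ⊆ q → ∣ q ∣ ≡ ℕ.suc ∣ p ∣ → ∃[ x ] (x ∈ q × p ≡ q - x)
codim-one-face {p = p} {q} p⊆q ∣q∣≡ with ⊆⇒≡⊎⊂ p⊆q
... | inj₁ refl = contradiction (sym ∣q∣≡) ℕₚ.1+n≢n
... | inj₂ (_ , x , x∈q , x∉p) = x , x∈q , ⊆∧∣∣≤⇒≡ p⊆q-x (ℕₚ.≤-reflexive (ℕₚ.suc-injective ∣q∣≡′))
  where
  p⊆q-x : p ⊆ q - x
  p⊆q-x y∈p = x∈p∧x≢y⇒x∈p-y (p⊆q y∈p) λ { refl → x∉p y∈p }
  ∣q∣≡′ : ℕ.suc ∣ q - x ∣ ≡ ℕ.suc ∣ p ∣
  ∣q∣≡′ = trans (sym (x∈p⇒∣p∣≡1+∣p-x∣ x∈q)) ∣q∣≡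

∣p∣≤0⇒x∉p : ∣ p ∣ ℕ.≤ 0 → x ∉ p
∣p∣≤0⇒x∉p ∣p∣≤0 x∈p = ℕₚ.<⇒≱ (x∈p⇒∣p-x∣<∣p∣ x∈p) (ℕₚ.≤-trans ∣p∣≤0 z≤n)

-- Until the iteration stabilises every step adds an element, so n + 1 steps suffice.
fold-stable : ∀ (F : Subset n → Subset n) → (∀ X → X ⊆ F X) →
              ∀ X → F (fold X F (ℕ.suc n)) ≡ fold X F (ℕ.suc n)
fold-stable {n} F inflationary X with progress (ℕ.suc n)
  where
  progress : ∀ k → F (fold X F k) ≡ fold X F k ⊎ k ℕ.≤ ∣ fold X F k ∣
  progress ℕ.zero    = inj₂ z≤n
  progress (ℕ.suc k) with progress k
  ... | inj₁ fixed = inj₁ (cong F fixed)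
  ... | inj₂ k≤ with ⊆⇒≡⊎⊂ (inflationary (fold X F k))
  ...   | inj₁ fixed = inj₁ (cong F (sym fixed))
  ...   | inj₂ grows = inj₂ (ℕₚ.≤-<-trans k≤ (p⊂q⇒∣p∣<∣q∣ grows))
... | inj₁ fixed   = fixed
... | inj₂ too-big = contradiction too-big (ℕₚ.<⇒≱ (s≤s (∣p∣≤n (fold X F (ℕ.suc n)))))

infix 4 _<ₗ_
_<ₗ_ : List ℕ → List ℕ → Set
_<ₗ_ = Lex-< _≡_ ℕ._<_

<ₗ-trans : ∀ {ks ls ms} → ks <ₗ ls → ls <ₗ ms → ks <ₗ ms
<ₗ-trans = Lex.<-transitive isEquivalence ℕₚ.<-resp₂-≡ ℕₚ.<-trans

<ₗ-irrefl : ∀ {ks : List ℕ} → ¬ ks <ₗ ks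
<ₗ-irrefl = Lex.<-irreflexive ℕₚ.<-irrefl (Pointwise.≡⇒Pointwise-≡ refl)

++⁺ˡ-<ₗ : ∀ ks {ls ms} → ls <ₗ ms → ks ++ ls <ₗ ks ++ ms
++⁺ˡ-<ₗ []       ls<ms = ls<ms
++⁺ˡ-<ₗ (k ∷ ks) ls<ms = next refl (++⁺ˡ-<ₗ ks ls<ms)

allSubsets : ∀ n → List (Subset n)
allSubsets ℕ.zero    = []ᵥ ∷ []
allSubsets (ℕ.suc n) = cartesianProductWith _∷ᵥ_ (inside ∷ outside ∷ []) (allSubsets n)

∈-allSubsets : ∀ (p : Subset n) → p ∈ₗ allSubsets n
∈-allSubsets []ᵥ             = here refl
∈-allSubsets (inside ∷ᵥ p)  =
  ∈-cartesianProductWith⁺ _∷ᵥ_ {xs = inside ∷ outside ∷ []} (here refl) (∈-allSubsets p)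
∈-allSubsets (outside ∷ᵥ p) =
  ∈-cartesianProductWith⁺ _∷ᵥ_ {xs = inside ∷ outside ∷ []} (there (here refl)) (∈-allSubsets p)

allSubsets-unique : ∀ n → Unique (allSubsets n)
allSubsets-unique ℕ.zero    = [] ∷ []
allSubsets-unique (ℕ.suc n) =
  Uniqueₚ.cartesianProductWith⁺ _∷ᵥ_ ∷-injective (((λ ()) ∷ []) ∷ [] ∷ []) (allSubsets-unique n)

Unique-lookup-injective : ∀ {A : Set} {xs : List A} → Unique xs →
                          ∀ i j → List.lookup xs i ≡ List.lookup xs j → i ≡ j
Unique-lookup-injective (_ ∷ _)      zero    zero    _  = refl
Unique-lookup-injective (x≢xs ∷ _)   zero    (suc j) eq = contradiction eq (All.lookup x≢xs (∈-lookup j))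
Unique-lookup-injective (x≢xs ∷ _)   (suc i) zero    eq =
  contradiction (sym eq) (All.lookup x≢xs (∈-lookup i))
Unique-lookup-injective (_ ∷ unique) (suc i) (suc j) eq =
  cong suc (Unique-lookup-injective unique i j eq)

-- The pivot matching

module GraphFacts (G : Graph) where

  private
    V : Set
    V = Fin (size G)

  adj⇒≢ : ∀ {x y : V} → adj G x y ≡ true → x ≢ y
  adj⇒≢ {x} x~x refl = true≢false x~x (adj-irrefl G x)

  Independent-⊆ : ∀ {p q} → q ⊆ p → Independent G p → Independent G q
  Independent-⊆ q⊆p ind x y x∈q y∈q = ind x y (q⊆p x∈q) (q⊆p y∈q)

  Independent-∪⁅⁆ : ∀ {σ v} → Independent G σ → (∀ z → z ∈ σ → adj G v z ≡ false) →
                    Independent G (σ ∪ ⁅ v ⁆)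
  Independent-∪⁅⁆ {σ} {v} ind v≁σ x y x∈ y∈ with x∈p∪⁅y⁆⁻ x∈ | x∈p∪⁅y⁆⁻ y∈
  ... | inj₁ x∈σ  | inj₁ y∈σ  = ind x y x∈σ y∈σ
  ... | inj₁ x∈σ  | inj₂ refl = trans (adj-sym G x y) (v≁σ x x∈σ)
  ... | inj₂ refl | inj₁ y∈σ  = v≁σ y y∈σ
  ... | inj₂ refl | inj₂ refl = adj-irrefl G x

  independent? : Decidable (Independent G)
  independent? σ = Finₚ.all? λ x → Finₚ.all? λ y →
    x ∈? σ →-dec y ∈? σ →-dec adj G x y Bool.≟ false

  Simplicial : Subset (size G) → V → Set
  Simplicial T v = ∀ {a b} → a ∈ T → b ∈ T → adj G v a ≡ true → adj G v b ≡ true → a ≢ b →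
                   adj G a b ≡ true

  Dominating : Subset (size G) → Set
  Dominating σ = ∀ y → y ∉ σ → ∃[ z ] (z ∈ σ × adj G y z ≡ true)

  dominating⇒maximal : ∀ {σ} → Independent G σ → Dominating σ → MaximalSimplex G σ
  dominating⇒maximal {σ} ind dom = ind , λ τ indτ σ⊆τ → ⊆-antisym (τ⊆σ indτ σ⊆τ) σ⊆τ
    where
    τ⊆σ : ∀ {τ} → Independent G τ → σ ⊆ τ → τ ⊆ σ
    τ⊆σ {τ} indτ σ⊆τ {y} y∈τ with y ∈? σ
    ... | yes y∈σ = y∈σ
    ... | no y∉σ  = let z , z∈σ , y~z = dom y y∉σ in
                    contradiction (indτ y z y∈τ (σ⊆τ z∈σ)) (true≢false y~z)

module Pruning (G : Graph) where

  private
    V : Set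
    V = Fin (size G)

  Survives : Subset (size G) → V → V → Pred V 0ℓ
  Survives T v u w = w ∈ T × w ≢ u × adj G u w ≡ false × (adj G v w ≡ true → u Fin.≤ w)

  survives? : ∀ T v u → Decidable (Survives T v u)
  survives? T v u w = w ∈? T ×-dec ¬? (w Finₚ.≟ u) ×-dec adj G u w Bool.≟ false
                      ×-dec (adj G v w Bool.≟ true →-dec u Finₚ.≤? w)

  prune : Subset (size G) → V → V → Subset (size G)
  prune T v u = ⟦ survives? T v u ⟧

  ∈-prune⁻ : ∀ {T v u w} → w ∈ prune T v u → Survives T v u w
  ∈-prune⁻ {T} {v} {u} = ∈⟦⟧⁻ {P? = survives? T v u}

  ∈-prune⁺ : ∀ {T v u w} → Survives T v u w → w ∈ prune T v u
  ∈-prune⁺ {T} {v} {u} = ∈⟦⟧⁺ {P? = survives? T v u}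

  prune⊂ : ∀ {T v u} → u ∈ T → prune T v u ⊂ T
  prune⊂ u∈T = proj₁ ∘ ∈-prune⁻ , _ , u∈T , λ u∈ → proj₁ (proj₂ (∈-prune⁻ u∈)) refl

  pruned : ∀ {T v u y} → y ∈ T → y ∉ prune T v u →
           y ≡ u ⊎ adj G u y ≡ true ⊎ (adj G v y ≡ true × y Fin.< u)
  pruned {T} {v} {u} {y} y∈T y∉ with y Finₚ.≟ u | adj G u y in u~y | adj G v y in v~y | u Finₚ.≤? y
  ... | yes y≡u | _     | _     | _       = inj₁ y≡u
  ... | no _    | true  | _     | _       = inj₂ (inj₁ refl)
  ... | no _    | false | true  | no u≰y  = inj₂ (inj₂ (refl , ℕₚ.≰⇒> u≰y))
  ... | no y≢u  | false | true  | yes u≤y = contradiction (∈-prune⁺ (y∈T , y≢u , u~y , λ _ → u≤y)) y∉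
  ... | no y≢u  | false | false | _       =
    contradiction (∈-prune⁺ (y∈T , y≢u , u~y , λ v~y′ → contradiction v~y (true≢false v~y′))) y∉

module PivotMatching (G : Graph)
  (choose : Subset (size G) → Maybe (Fin (size G)))
  (choose-∈ : ∀ {T v} → choose T ≡ just v → v ∈ T) where

  open GraphFacts G
  open Pruning G

  private
    N : ℕ
    N = size G
    V : Set
    V = Fin N
    VSet : Set
    VSet = Subset N

  Hit : VSet → VSet → V → Pred V 0ℓ
  Hit T σ v w = w ∈ σ × w ∈ T × adj G v w ≡ true

  hit? : ∀ T σ v → Decidable (Hit T σ v)
  hit? T σ v w = w ∈? σ ×-dec w ∈? T ×-dec adj G v w Bool.≟ true

  Trace : Set
  Trace = List ℕ × Maybe V

  walk : ℕ → VSet → VSet → Trace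
  walk zero    T σ = [] , nothing
  walk (suc f) T σ with choose T
  ... | nothing = [] , nothing
  ... | just v with least (hit? T σ v)
  ...   | nothing = [] , just v
  ...   | just u  = map₁ (N ∸ toℕ u ∷_) (walk f (prune T v u) σ)

  walk-pivot-∈ : ∀ f T σ {v} → proj₂ (walk f T σ) ≡ just v → v ∈ T
  walk-pivot-∈ (suc f) T σ eq with choose T in chosen
  ... | nothing = contradiction eq λ ()
  ... | just v with least (hit? T σ v)
  ...   | nothing = subst (_∈ T) (just-injective eq) (choose-∈ chosen)
  ...   | just u  = proj₁ (∈-prune⁻ (walk-pivot-∈ f (prune T v u) σ eq))

  ∈-agree : ∀ {σ σ′ : VSet} {v w} → σ′ - v ≡ σ - v → w ≢ v → w ∈ σ′ → w ∈ σ
  ∈-agree σ′≈σ w≢v w∈σ′ = x∈p-y⇒x∈p (subst (_ ∈_) σ′≈σ (x∈p∧x≢y⇒x∈p-y w∈σ′ w≢v))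

  hit-remove : ∀ {T σ v x w} → Hit T (σ - x) v w → Hit T σ v w
  hit-remove (w∈ , w∈T , v~w) = x∈p-y⇒x∈p w∈ , w∈T , v~w

  hit-keep : ∀ {T σ v x w} → w ≢ x → Hit T σ v w → Hit T (σ - x) v w
  hit-keep w≢x (w∈σ , w∈T , v~w) = x∈p∧x≢y⇒x∈p-y w∈σ w≢x , w∈T , v~w

  hit-agree : ∀ {T σ σ′ v v₀ w} → σ′ - v ≡ σ - v → w ≢ v → Hit T σ′ v₀ w → Hit T σ v₀ w
  hit-agree σ′≈σ w≢v (w∈σ′ , w∈T , v₀~w) = ∈-agree σ′≈σ w≢v w∈σ′ , w∈T , v₀~w

  no-hit-agree : ∀ {T σ σ′ v} → σ′ - v ≡ σ - v → Least (Hit T σ v) nothing →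
                 Least (Hit T σ′ v) nothing
  no-hit-agree σ′≈σ (none ¬hit) =
    none λ w hit′ → ¬hit w (hit-agree σ′≈σ (≢-sym (adj⇒≢ (proj₂ (proj₂ hit′)))) hit′)

  least-hit-agree : ∀ {T σ σ′ v v₀ u} → σ′ - v ≡ σ - v → Survives T v₀ u v →
                    Least (Hit T σ v₀) (just u) → Least (Hit T σ′ v₀) (just u)
  least-hit-agree {T} {σ} {σ′} {v} {v₀} {u} σ′≈σ (_ , v≢u , _ , v₀~v⇒u≤v) (some hit-u min-u) =
    some (hit-agree (sym σ′≈σ) (≢-sym v≢u) hit-u) min-u′
    where
    min-u′ : ∀ {w} → Hit T σ′ v₀ w → u Fin.≤ w
    min-u′ {w} hit′ with w Finₚ.≟ v
    ... | yes refl = v₀~v⇒u≤v (proj₂ (proj₂ hit′))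
    ... | no w≢v   = min-u (hit-agree σ′≈σ w≢v hit′)

  -- The pivot survives every pruning, so it is neither the least hit nor below it.
  walk-stable : ∀ f T {σ σ′ v} → proj₂ (walk f T σ) ≡ just v → σ′ - v ≡ σ - v →
                walk f T σ′ ≡ walk f T σ
  walk-stable (suc f) T {σ} {σ′} eq σ′≈σ with choose T
  ... | just v₀ with least (hit? T σ v₀) | least-spec (hit? T σ v₀)
  ...   | nothing | spec
    rewrite least-≡ (hit? T σ′ v₀)
              (no-hit-agree (subst (λ v → σ′ - v ≡ σ - v) (sym (just-injective eq)) σ′≈σ) spec) =
      refl
  ...   | just u | spec
    rewrite least-≡ (hit? T σ′ v₀)
              (least-hit-agree σ′≈σ (∈-prune⁻ (walk-pivot-∈ f (prune T v₀ u) σ eq)) spec) =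
      cong (map₁ (N ∸ toℕ u ∷_)) (walk-stable f (prune T v₀ u) eq σ′≈σ)

  missing : V → VSet → ℕ
  missing v σ = if does (v ∈? σ) then 0 else 1

  -- Adding the pivot, and removing any other vertex, makes the weight drop.
  weight : Maybe V → VSet → ℕ
  weight nothing  σ = ∣ σ ∣
  weight (just v) σ = ∣ σ - v ∣ + missing v σ

  -- Every recorded entry N ∸ u is positive, so a walk that stops earlier gives a smaller list.
  measure : Trace → VSet → List ℕ
  measure t σ = proj₁ t ++ 0 ∷ weight (proj₂ t) σ ∷ []

  missing-cong : ∀ {v σ σ′} → (v ∈ σ′ ⇔ v ∈ σ) → missing v σ′ ≡ missing v σ
  missing-cong {v} {σ} {σ′} v∈⇔ = cong (if_then 0 else 1) (does-⇔ v∈⇔ (v ∈? σ′) (v ∈? σ))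

  weight-down : ∀ {σ v x} → x ∈ σ → x ≢ v → weight (just v) (σ - x) ℕ.< weight (just v) σ
  weight-down {σ} {v} {x} x∈σ x≢v = begin-strict
    ∣ σ - x - v ∣ + missing v (σ - x)  ≡⟨ cong₂ _+_ (cong ∣_∣ (p─x─y≡p─y─x σ x v)) (missing-cong v∈⇔) ⟩
    ∣ σ - v - x ∣ + missing v σ        <⟨ ℕₚ.+-monoˡ-< _ (x∈p⇒∣p-x∣<∣p∣ (x∈p∧x≢y⇒x∈p-y x∈σ x≢v)) ⟩
    ∣ σ - v ∣ + missing v σ            ∎
    where
    open ℕₚ.≤-Reasoning
    v∈⇔ : v ∈ σ - x ⇔ v ∈ σ
    v∈⇔ = mk⇔ x∈p-y⇒x∈p λ v∈σ → x∈p∧x≢y⇒x∈p-y v∈σ (≢-sym x≢v)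

  weight-up : ∀ {σ v} → v ∉ σ → weight (just v) (σ ∪ ⁅ v ⁆) ℕ.< weight (just v) σ
  weight-up {σ} {v} v∉σ
    rewrite [p∪⁅x⁆]-x≡p-x σ v | dec-true (v ∈? σ ∪ ⁅ v ⁆) (x∈p∪⁅x⁆ σ v) | dec-false (v ∈? σ) v∉σ =
      ℕₚ.+-monoʳ-< ∣ σ - v ∣ ℕₚ.0<1+n

  walk-down : ∀ f T {σ x} → x ∈ σ →
              measure (walk f T (σ - x)) (σ - x) <ₗ measure (walk f T σ) σ
              ⊎ proj₂ (walk f T σ) ≡ just x
  walk-down zero T x∈σ = inj₁ (next refl (this (x∈p⇒∣p-x∣<∣p∣ x∈σ)))
  walk-down (suc f) T {σ} {x} x∈σ with choose T
  ... | nothing = inj₁ (next refl (this (x∈p⇒∣p-x∣<∣p∣ x∈σ)))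
  ... | just v with least (hit? T σ v) | least-spec (hit? T σ v)
  ...   | nothing | none ¬hit
    rewrite least-≡ (hit? T (σ - x) v) (none λ w → ¬hit w ∘ hit-remove) with x Finₚ.≟ v
  ...     | yes refl = inj₂ refl
  ...     | no x≢v   = inj₁ (next refl (this (weight-down x∈σ x≢v)))
  walk-down (suc f) T {σ} {x} x∈σ | just v | just u | some hit-u min-u with x Finₚ.≟ u
  ...     | no x≢u
    rewrite least-≡ (hit? T (σ - x) v)
              (some (hit-keep (≢-sym x≢u) hit-u) (min-u ∘ hit-remove)) =
      Sum.map₁ (next refl) (walk-down f (prune T v u) x∈σ)
  ...     | yes refl with least (hit? T (σ - x) v) | least-spec (hit? T (σ - x) v)
  ...       | nothing | _ = inj₁ (this (ℕₚ.m<n⇒0<n∸m (Finₚ.toℕ<n x)))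
  ...       | just u′ | some hit-u′ _ =
    inj₁ (this (ℕₚ.∸-monoʳ-< (Finₚ.≤∧≢⇒< (min-u (hit-remove hit-u′)) x≢u′)
                             (ℕₚ.<⇒≤ (Finₚ.toℕ<n u′))))
    where
    x≢u′ : x ≢ u′
    x≢u′ x≡u′ = x∈p-y⇒x≢y (proj₁ hit-u′) (sym x≡u′)

  walk-up : ∀ f T {σ v} → proj₂ (walk f T σ) ≡ just v → v ∉ σ →
            measure (walk f T (σ ∪ ⁅ v ⁆)) (σ ∪ ⁅ v ⁆) <ₗ measure (walk f T σ) σ
  walk-up f T {σ} {v} eq v∉σ
    rewrite walk-stable f T eq ([p∪⁅x⁆]-x≡p-x σ v) = measure-up (walk f T σ) eq
    where
    measure-up : ∀ t → proj₂ t ≡ just v → measure t (σ ∪ ⁅ v ⁆) <ₗ measure t σ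
    measure-up (ks , _) refl = ++⁺ˡ-<ₗ ks (next refl (this (weight-up v∉σ)))

  pivot : VSet → Maybe V
  pivot σ = proj₂ (walk N ⊤ σ)

  potential : VSet → List ℕ
  potential σ = measure (walk N ⊤ σ) σ

  pivot-stable : ∀ {σ σ′ v} → pivot σ ≡ just v → σ′ - v ≡ σ - v → pivot σ′ ≡ just v
  pivot-stable eq σ′≈σ = trans (cong proj₂ (walk-stable N ⊤ eq σ′≈σ)) eq

  Raisable : VSet → V → Set
  Raisable α v = v ∉ α × Independent G α × Independent G (α ∪ ⁅ v ⁆)

  MatchedUp : VSet → V → Set
  MatchedUp α v = pivot α ≡ just v × Raisable α v

  Lower : VSet → Set
  Lower α = ∃ (MatchedUp α)

  lower? : Decidable Lower
  lower? α = lower-at? (pivot α) refl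
    where
    lower-at? : ∀ m → pivot α ≡ m → Dec (Lower α)
    lower-at? nothing  eq = no λ (_ , eq′ , _) → contradiction (trans (sym eq) eq′) λ ()
    lower-at? (just v) eq = Dec.map′ (λ r → v , eq , r) from
                              (¬? (v ∈? α) ×-dec independent? α ×-dec independent? (α ∪ ⁅ v ⁆))
      where
      from : Lower α → Raisable α v
      from (v′ , eq′ , r) = subst (Raisable α) (just-injective (trans (sym eq′) eq)) r

  raise : VSet → VSet
  raise α = maybe′ (λ v → α ∪ ⁅ v ⁆) α (pivot α)

  matching : Matching G
  matching = List.map (λ α → α , raise α) (List.filter lower? (allSubsets N))

  ∈-matching⁻ : ∀ {α β} → (α , β) ∈ₗ matching → ∃[ v ] (MatchedUp α v × β ≡ α ∪ ⁅ v ⁆)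
  ∈-matching⁻ m with ∈-map⁻ _ m
  ... | α , α∈ , refl with proj₂ (∈-filter⁻ lower? {xs = allSubsets N} α∈)
  ...   | v , mu = v , mu , cong (maybe′ (λ v → α ∪ ⁅ v ⁆) α) (proj₁ mu)

  ∈-matching⁺ : ∀ {α v} → MatchedUp α v → (α , α ∪ ⁅ v ⁆) ∈ₗ matching
  ∈-matching⁺ {α} {v} mu =
    subst (λ β → (α , β) ∈ₗ matching) (cong (maybe′ (λ v → α ∪ ⁅ v ⁆) α) (proj₁ mu))
      (∈-map⁺ _ (∈-filter⁺ lower? (∈-allSubsets α) (v , mu)))

  matching-unique : Unique matching
  matching-unique = Uniqueₚ.map⁺ (cong proj₁) (Uniqueₚ.filter⁺ lower? (allSubsets-unique N))

  pivot-raise : ∀ {α v} → MatchedUp α v → pivot (α ∪ ⁅ v ⁆) ≡ just v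
  pivot-raise {α} {v} (eq , _) = pivot-stable eq ([p∪⁅x⁆]-x≡p-x α v)

  lower-unique : ∀ {α₁ α₂ v₁ v₂} → MatchedUp α₁ v₁ → MatchedUp α₂ v₂ →
                 α₁ ∪ ⁅ v₁ ⁆ ≡ α₂ ∪ ⁅ v₂ ⁆ → α₁ ≡ α₂
  lower-unique {α₁} {α₂} {v₁} mu₁ mu₂ eq with
    just-injective (trans (sym (pivot-raise mu₁)) (trans (cong pivot eq) (pivot-raise mu₂)))
  ... | refl = begin
    α₁                    ≡⟨ x∉p⇒p-x≡p (proj₁ (proj₂ mu₁)) ⟨
    α₁ - v₁               ≡⟨ [p∪⁅x⁆]-x≡p-x α₁ v₁ ⟨
    (α₁ ∪ ⁅ v₁ ⁆) - v₁    ≡⟨ cong (_- v₁) eq ⟩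
    (α₂ ∪ ⁅ v₁ ⁆) - v₁    ≡⟨ [p∪⁅x⁆]-x≡p-x α₂ v₁ ⟩
    α₂ - v₁               ≡⟨ x∉p⇒p-x≡p (proj₁ (proj₂ mu₂)) ⟩
    α₂                    ∎
    where open ≡-Reasoning

  lower≢upper : ∀ {α₁ α₂ v₁ v₂} → MatchedUp α₁ v₁ → MatchedUp α₂ v₂ → α₁ ≢ α₂ ∪ ⁅ v₂ ⁆
  lower≢upper {α₂ = α₂} {v₂ = v₂} (eq₁ , v₁∉α₁ , _) mu₂ refl
    with just-injective (trans (sym eq₁) (pivot-raise mu₂))
  ... | refl = v₁∉α₁ (x∈p∪⁅x⁆ α₂ v₂)

  shared-lower : ∀ {α₁ α₂ v₁ v₂ σ} → MatchedUp α₁ v₁ → MatchedUp α₂ v₂ →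
                 σ ≡ α₁ ⊎ σ ≡ α₁ ∪ ⁅ v₁ ⁆ → σ ≡ α₂ ⊎ σ ≡ α₂ ∪ ⁅ v₂ ⁆ → α₁ ≡ α₂
  shared-lower mu₁ mu₂ (inj₁ refl) (inj₁ refl) = refl
  shared-lower mu₁ mu₂ (inj₁ refl) (inj₂ eq)   = contradiction eq (lower≢upper mu₁ mu₂)
  shared-lower mu₁ mu₂ (inj₂ eq)   (inj₁ refl) = contradiction eq (lower≢upper mu₂ mu₁)
  shared-lower mu₁ mu₂ (inj₂ eq₁)  (inj₂ eq₂)  = lower-unique mu₁ mu₂ (trans (sym eq₁) eq₂)

  matched-once : ∀ {p q σ} → p ∈ₗ matching → q ∈ₗ matching → InPair σ p → InPair σ q → p ≡ q
  matched-once m₁ m₂ in₁ in₂ with ∈-matching⁻ m₁ | ∈-matching⁻ m₂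
  ... | v₁ , mu₁ , refl | v₂ , mu₂ , refl with shared-lower mu₁ mu₂ in₁ in₂
  ...   | refl with just-injective (trans (sym (proj₁ mu₁)) (proj₁ mu₂))
  ...     | refl = refl

  matched-faces : ∀ α β → (α , β) ∈ₗ matching →
                  Independent G α × Independent G β × CodimOneFace α β
  matched-faces α β m with ∈-matching⁻ m
  ... | v , (_ , v∉α , indα , indβ) , refl =
    indα , indβ , (λ x∈α → x∈p∪q⁺ (inj₁ x∈α)) , x∉p⇒∣p∪⁅x⁆∣≡1+∣p∣ v∉α

  matched-down : ∀ {σ x} → x ∈ σ → Independent G σ → pivot σ ≡ just x → MatchedUp (σ - x) x
  matched-down {σ} {x} x∈σ indσ eq =
    pivot-stable eq (p─q─q≡p─q σ ⁅ x ⁆) ,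
    (λ x∈ → x∈p-y⇒x≢y x∈ refl) ,
    Independent-⊆ x∈p-y⇒x∈p indσ ,
    subst (Independent G) (sym (x∈p⇒[p-x]∪⁅x⁆≡p x∈σ)) indσ

  edge-descends : ∀ {σ τ} → ModEdge G matching σ τ → potential τ <ₗ potential σ
  edge-descends {σ} (indσ , _ , inj₁ ((τ⊆σ , ∣σ∣≡) , τσ∉M)) with codim-one-face τ⊆σ ∣σ∣≡
  ... | x , x∈σ , refl with walk-down N ⊤ x∈σ
  ...   | inj₁ descends = descends
  ...   | inj₂ eq = contradiction
    (subst (λ β → (σ - x , β) ∈ₗ matching) (x∈p⇒[p-x]∪⁅x⁆≡p x∈σ)
      (∈-matching⁺ (matched-down x∈σ indσ eq)))
    τσ∉M
  edge-descends (_ , _ , inj₂ m) with ∈-matching⁻ m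
  ... | v , (eq , v∉σ , _) , refl = walk-up N ⊤ eq v∉σ

  descent : ∀ {σ τ} → TransClosure (ModEdge G matching) σ τ → potential τ <ₗ potential σ
  descent [ e ]⁺   = edge-descends e
  descent (e ∷ es) = <ₗ-trans (descent es) (edge-descends e)

  matching-acyclic : IsAcyclicMatching G matching
  matching-acyclic =
    matched-faces ,
    (λ i j σ in₁ in₂ → Unique-lookup-injective matching-unique i j
                         (matched-once (∈-lookup i) (∈-lookup j) in₁ in₂)) ,
    λ σ cycle → <ₗ-irrefl (descent cycle)

  Sound : Maybe V → VSet → Set
  Sound nothing  σ = Dominating σ
  Sound (just v) σ = v ∉ σ → ∀ z → z ∈ σ → adj G v z ≡ false

  module _ (pivot-sound : ∀ σ → Independent G σ → Sound (pivot σ) σ) where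

    unmatched-maximal : ∀ {σ} → Independent G σ → ¬ Paired G matching σ → MaximalSimplex G σ
    unmatched-maximal {σ} indσ unpaired with pivot σ in eq | pivot-sound σ indσ
    ... | nothing | dominating = dominating⇒maximal indσ dominating
    ... | just v  | isolated with v ∈? σ
    ...   | no v∉σ = contradiction
      (_ , ∈-matching⁺ (eq , v∉σ , indσ , Independent-∪⁅⁆ indσ (isolated v∉σ)) , inj₁ refl)
      unpaired
    ...   | yes v∈σ = contradiction
      (_ , ∈-matching⁺ (matched-down v∈σ indσ eq) , inj₂ (sym (x∈p⇒[p-x]∪⁅x⁆≡p v∈σ)))
      unpaired

    critical-cells : ∀ σ → Critical G matching σ →
                     MaximalSimplex G σ ⊎ ∃[ v ] (pivot ⊥ ≡ just v × σ ≡ ⁅ v ⁆)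
    critical-cells σ (indσ , _ , inj₁ unpaired) = inj₁ (unmatched-maximal indσ unpaired)
    critical-cells σ (_ , _ , inj₂ (inj₁ m)) with ∈-matching⁻ m
    ... | v , (eq , _) , refl = inj₂ (v , eq , ∪-identityˡ ⁅ v ⁆)
    critical-cells σ (_ , _ , inj₂ (inj₂ m)) with ∈-matching⁻ m
    ... | v , _ , ⊥≡σ∪v = contradiction (subst (v ∈_) (sym ⊥≡σ∪v) (x∈p∪⁅x⁆ σ v)) ∉⊥

    pivot-matching-theorem :
      Σ (Matching G) λ M → IsAcyclicMatching G M ×
        Σ (Maybe V) λ w → ∀ σ → Critical G M σ →
          MaximalSimplex G σ ⊎ (∃[ v ] (w ≡ just v × σ ≡ ⁅ v ⁆))
    pivot-matching-theorem = matching , matching-acyclic , pivot ⊥ , critical-cells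

-- Simplicial elimination strategies

record Strategy (G : Graph) : Set₁ where
  open GraphFacts G
  open Pruning G
  field
    Admissible        : Subset (size G) → Set
    choose            : Subset (size G) → Maybe (Fin (size G))
    choose-∈          : ∀ {T v} → choose T ≡ just v → v ∈ T
    choose-simplicial : ∀ {T v} → Admissible T → choose T ≡ just v → Simplicial T v
    choose-exhaustive : ∀ {T} → Admissible T → choose T ≡ nothing → ∀ x → x ∉ T
    admissible-⊤      : Admissible ⊤
    admissible-prune  : ∀ {T v u} → Admissible T → choose T ≡ just v → u ∈ T →
                        adj G v u ≡ true → Admissible (prune T v u)

module _ {G : Graph} (S : Strategy G) where

  open Strategy S
  open GraphFacts G
  open Pruning G
  open PivotMatching G choose choose-∈

  private
    VSet : Set
    VSet = Subset (size G)

  record Invariant (T σ : VSet) : Set where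
    field
      dominated : ∀ {y} → y ∉ T → y ∉ σ → ∃[ z ] (z ∈ σ × adj G y z ≡ true)
      detached  : ∀ {z y} → z ∈ σ → z ∉ T → y ∈ T → adj G y z ≡ false

  invariant-⊤ : ∀ {σ} → Invariant ⊤ σ
  invariant-⊤ = record
    { dominated = λ y∉⊤ _ → contradiction ∈⊤ y∉⊤
    ; detached  = λ _ z∉⊤ _ → contradiction ∈⊤ z∉⊤
    }

  emptied-sound : ∀ {T σ} → Invariant T σ → (∀ x → x ∉ T) → Sound nothing σ
  emptied-sound inv T-empty y y∉σ = Invariant.dominated inv (T-empty y) y∉σ

  invariant-prune : ∀ {T σ v u} → Admissible T → choose T ≡ just v →
                    Independent G σ → Least (Hit T σ v) (just u) →
                    Invariant T σ → Invariant (prune T v u) σ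
  invariant-prune {T} {σ} {v} {u} adm chosen indσ (some (u∈σ , u∈T , v~u) min-u) inv =
    record { dominated = dominated′ ; detached = detached′ }
    where
    open Invariant inv
    dominated′ : ∀ {y} → y ∉ prune T v u → y ∉ σ → ∃[ z ] (z ∈ σ × adj G y z ≡ true)
    dominated′ {y} y∉T′ y∉σ with y ∈? T
    ... | no y∉T = dominated y∉T y∉σ
    ... | yes y∈T with pruned y∈T y∉T′
    ...   | inj₁ refl = contradiction u∈σ y∉σ
    ...   | inj₂ (inj₁ u~y) = u , u∈σ , trans (adj-sym G y u) u~y
    ...   | inj₂ (inj₂ (v~y , y<u)) =
      u , u∈σ , choose-simplicial adm chosen y∈T u∈T v~y v~u (λ { refl → Finₚ.<-irrefl refl y<u })
    detached′ : ∀ {z y} → z ∈ σ → z ∉ prune T v u → y ∈ prune T v u → adj G y z ≡ false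
    detached′ {z} {y} z∈σ z∉T′ y∈T′ with z ∈? T
    ... | no z∉T = detached z∈σ z∉T (proj₁ (∈-prune⁻ y∈T′))
    ... | yes z∈T with pruned z∈T z∉T′
    ...   | inj₁ refl = trans (adj-sym G y z) (proj₁ (proj₂ (proj₂ (∈-prune⁻ y∈T′))))
    ...   | inj₂ (inj₁ u~z) = contradiction (indσ u z u∈σ z∈σ) (true≢false u~z)
    ...   | inj₂ (inj₂ (v~z , z<u)) = contradiction (min-u (z∈σ , z∈T , v~z)) (ℕₚ.<⇒≱ z<u)

  walk-sound : ∀ f T {σ} → Admissible T → ∣ T ∣ ℕ.≤ f → Independent G σ → Invariant T σ →
               Sound (proj₂ (walk f T σ)) σ
  walk-sound zero T adm ∣T∣≤0 indσ inv =
    emptied-sound inv λ _ → ∣p∣≤0⇒x∉p ∣T∣≤0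
  walk-sound (suc f) T {σ} adm ∣T∣≤ indσ inv with choose T in chosen
  ... | nothing = emptied-sound inv (choose-exhaustive adm chosen)
  ... | just v with least (hit? T σ v) | least-spec (hit? T σ v)
  ...   | nothing | none ¬hit = isolated
    where
    isolated : v ∉ σ → ∀ z → z ∈ σ → adj G v z ≡ false
    isolated v∉σ z z∈σ with z ∈? T
    ... | no z∉T  = Invariant.detached inv z∈σ z∉T (choose-∈ chosen)
    ... | yes z∈T with adj G v z in v~z
    ...   | false = refl
    ...   | true  = contradiction (z∈σ , z∈T , v~z) (¬hit z)
  ...   | just u | hit-u@(some (_ , u∈T , v~u) _) =
    walk-sound f (prune T v u) (admissible-prune adm chosen u∈T v~u)
      (ℕₚ.≤-pred (ℕₚ.<-≤-trans (p⊂q⇒∣p∣<∣q∣ (prune⊂ u∈T)) ∣T∣≤)) indσ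
      (invariant-prune adm chosen indσ hit-u inv)

  pivot-sound : ∀ σ → Independent G σ → Sound (pivot σ) σ
  pivot-sound σ indσ = walk-sound (size G) ⊤ admissible-⊤ (ℕₚ.≤-reflexive (∣⊤∣≡n _)) indσ invariant-⊤

  strategy-theorem :
    Σ (Matching G) λ M → IsAcyclicMatching G M ×
      Σ (Maybe (Fin (size G))) λ w → ∀ σ → Critical G M σ →
        MaximalSimplex G σ ⊎ (∃[ v ] (w ≡ just v × σ ≡ ⁅ v ⁆))
  strategy-theorem = pivot-matching-theorem pivot-sound

-- The class 𝒢_{m,n}

module ClassGStrategy (G : Graph) (m n : ℕ) (G∈𝒢 : InClassG m n G) where

  open GraphFacts G
  open Pruning G

  private
    V : Set
    V = Fin (size G)
    VSet : Set
    VSet = Subset (size G)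
    ℓ₁ : V → Fin (suc m)
    ℓ₁ = proj₁ G∈𝒢
    ℓ₂ : V → Fin (suc n)
    ℓ₂ = proj₁ (proj₂ G∈𝒢)

  lab₁ lab₂ : V → ℕ
  lab₁ x = toℕ (ℓ₁ x)
  lab₂ x = toℕ (ℓ₂ x)

  _≼_ : V → V → Set
  x ≼ y = lab₁ x ≤ lab₁ y × lab₂ x ≤ lab₂ y

  Comparable : V → V → Set
  Comparable x y = x ≼ y ⊎ y ≼ x

  every-label-used : ∀ i j → ∃ λ x → ℓ₁ x ≡ i × ℓ₂ x ≡ j
  every-label-used = proj₁ (proj₂ (proj₂ G∈𝒢))

  adj⇒comparable : ∀ {x y} → adj G x y ≡ true → Comparable x y
  adj⇒comparable x~y = proj₁ (proj₂ (proj₂ (proj₂ G∈𝒢)) _ _ (adj⇒≢ x~y)) x~y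

  comparable⇒adj : ∀ {x y} → x ≢ y → Comparable x y → adj G x y ≡ true
  comparable⇒adj x≢y = proj₂ (proj₂ (proj₂ (proj₂ G∈𝒢)) _ _ x≢y)

  incomparable⇒non-adj : ∀ {x y} → ¬ Comparable x y → adj G x y ≡ false
  incomparable⇒non-adj {x} {y} ∤ with adj G x y in x~y
  ... | false = refl
  ... | true  = contradiction (adj⇒comparable x~y) ∤

  incomparable⇒crossing : ∀ {x y} → ¬ Comparable x y →
                 (lab₁ x < lab₁ y × lab₂ y < lab₂ x) ⊎ (lab₁ y < lab₁ x × lab₂ x < lab₂ y)
  incomparable⇒crossing {x} {y} ∤ with ℕₚ.<-cmp (lab₁ x) (lab₁ y) | lab₂ x ≤? lab₂ y
  ... | tri< x<y _ _ | no  x≰y = inj₁ (x<y , ℕₚ.≰⇒> x≰y)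
  ... | tri< x<y _ _ | yes x≤y = contradiction (inj₁ (ℕₚ.<⇒≤ x<y , x≤y)) ∤
  ... | tri≈ _ x≡y _ | yes x≤y = contradiction (inj₁ (ℕₚ.≤-reflexive x≡y , x≤y)) ∤
  ... | tri≈ _ x≡y _ | no  x≰y =
    contradiction (inj₂ (ℕₚ.≤-reflexive (sym x≡y) , ℕₚ.<⇒≤ (ℕₚ.≰⇒> x≰y))) ∤
  ... | tri> _ _ y<x | yes x≤y =
    inj₂ (y<x , ℕₚ.≤∧≢⇒< x≤y λ x≡y → ∤ (inj₂ (ℕₚ.<⇒≤ y<x , ℕₚ.≤-reflexive (sym x≡y))))
  ... | tri> _ _ y<x | no  x≰y = contradiction (inj₂ (ℕₚ.<⇒≤ y<x , ℕₚ.<⇒≤ (ℕₚ.≰⇒> x≰y))) ∤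

  InRegion : ℕ → ℕ → Pred V 0ℓ
  InRegion p q x = lab₁ x < p × q ≤ lab₂ x

  region : ℕ → ℕ → VSet
  region p q = ⟦ (λ x → lab₁ x <? p ×-dec q ≤? lab₂ x) ⟧

  ∈-region⁺ : ∀ p q {x} → InRegion p q x → x ∈ region p q
  ∈-region⁺ p q = ∈⟦⟧⁺ {P? = λ x → lab₁ x <? p ×-dec q ≤? lab₂ x}

  ∈-region⁻ : ∀ p q {x} → x ∈ region p q → InRegion p q x
  ∈-region⁻ p q = ∈⟦⟧⁻ {P? = λ x → lab₁ x <? p ×-dec q ≤? lab₂ x}

  Corner : VSet → V → Set
  Corner T x = ∀ y → y ∈ T → lab₁ y ≤ lab₁ x × lab₂ x ≤ lab₂ y

  Chosen : VSet → Pred V 0ℓ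
  Chosen T x = x ∈ T × Corner T x

  corner? : ∀ T x → Dec (Corner T x)
  corner? T x = Finₚ.all? λ y → y ∈? T →-dec (lab₁ y ≤? lab₁ x ×-dec lab₂ x ≤? lab₂ y)

  choose : VSet → Maybe V
  choose T = least λ x → x ∈? T ×-dec corner? T x

  choose-spec : ∀ T → Least (Chosen T) (choose T)
  choose-spec T = least-spec _

  chosen : ∀ {T v} → choose T ≡ just v → Chosen T v
  chosen {T} eq with subst (Least (Chosen T)) eq (choose-spec T)
  ... | some chosen-v _ = chosen-v

  labelled-corner : ∀ {p₀ q w} → lab₁ w ≡ p₀ → lab₂ w ≡ q → Chosen (region (suc p₀) q) w
  labelled-corner refl refl =
    ∈-region⁺ _ _ (ℕₚ.≤-refl , ℕₚ.≤-refl) , λ y y∈ → map₁ ℕₚ.≤-pred (∈-region⁻ _ _ y∈)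

  corner-exists : ∀ p q {x} → p ≤ suc m → x ∈ region p q → ∃ (Chosen (region p q))
  corner-exists zero     q _  x∈ = contradiction (proj₁ (∈-region⁻ zero q x∈)) ℕₚ.n≮0
  corner-exists (suc p₀) q {x} p≤ x∈ with every-label-used (fromℕ< p≤) (fromℕ< q<1+n)
    where
    q<1+n : q < suc n
    q<1+n = ℕₚ.≤-<-trans (proj₂ (∈-region⁻ (suc p₀) q x∈)) (Finₚ.toℕ<n (ℓ₂ x))
  ... | w , ℓ₁w≡ , ℓ₂w≡ =
    w , labelled-corner (trans (cong toℕ ℓ₁w≡) (Finₚ.toℕ-fromℕ< _))
                        (trans (cong toℕ ℓ₂w≡) (Finₚ.toℕ-fromℕ< _))

  column-or-row : ∀ {T v a} → Corner T v → a ∈ T → adj G v a ≡ true →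
                  lab₁ a ≡ lab₁ v ⊎ lab₂ a ≡ lab₂ v
  column-or-row {a = a} corner a∈T v~a with adj⇒comparable v~a | corner a a∈T
  ... | inj₁ (v₁≤a₁ , _) | a₁≤v₁ , _ = inj₁ (ℕₚ.≤-antisym a₁≤v₁ v₁≤a₁)
  ... | inj₂ (_ , a₂≤v₂) | _ , v₂≤a₂ = inj₂ (ℕₚ.≤-antisym a₂≤v₂ v₂≤a₂)

  corner-simplicial : ∀ {T v} → Corner T v → Simplicial T v
  corner-simplicial {T} {v} corner {a} {b} a∈T b∈T v~a v~b a≢b =
    comparable⇒adj a≢b (line (column-or-row corner a∈T v~a) (column-or-row corner b∈T v~b))
    where
    line : _ → _ → Comparable a b
    line (inj₁ a₁≡v₁) (inj₁ b₁≡v₁) with ℕₚ.≤-total (lab₂ a) (lab₂ b)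
    ... | inj₁ a₂≤b₂ = inj₁ (ℕₚ.≤-reflexive (trans a₁≡v₁ (sym b₁≡v₁)) , a₂≤b₂)
    ... | inj₂ b₂≤a₂ = inj₂ (ℕₚ.≤-reflexive (trans b₁≡v₁ (sym a₁≡v₁)) , b₂≤a₂)
    line (inj₂ a₂≡v₂) (inj₂ b₂≡v₂) with ℕₚ.≤-total (lab₁ a) (lab₁ b)
    ... | inj₁ a₁≤b₁ = inj₁ (a₁≤b₁ , ℕₚ.≤-reflexive (trans a₂≡v₂ (sym b₂≡v₂)))
    ... | inj₂ b₁≤a₁ = inj₂ (b₁≤a₁ , ℕₚ.≤-reflexive (trans b₂≡v₂ (sym a₂≡v₂)))
    line (inj₁ a₁≡v₁) (inj₂ b₂≡v₂) =
      inj₂ (subst (lab₁ b ≤_) (sym a₁≡v₁) (proj₁ (corner b b∈T)) ,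
            subst (_≤ lab₂ a) (sym b₂≡v₂) (proj₂ (corner a a∈T)))
    line (inj₂ a₂≡v₂) (inj₁ b₁≡v₁) =
      inj₁ (subst (lab₁ a ≤_) (sym b₁≡v₁) (proj₁ (corner a a∈T)) ,
            subst (_≤ lab₂ b) (sym a₂≡v₂) (proj₂ (corner b b∈T)))

  -- Whether u shares the first or the second label of the corner v, the vertices of the region
  -- incomparable with u are exactly those of the smaller region, and none of them is adjacent to v.
  prune-corner : ∀ p q {v u} → Corner (region p q) v → u ∈ region p q → adj G v u ≡ true →
                 prune (region p q) v u ≡ region (lab₁ u) (suc (lab₂ u))
  prune-corner p q {v} {u} corner u∈T v~u = ⊆-antisym pruned⊆ ⊆pruned
    where
    u₁≤v₁ : lab₁ u ≤ lab₁ v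
    u₁≤v₁ = proj₁ (corner u u∈T)
    v₂≤u₂ : lab₂ v ≤ lab₂ u
    v₂≤u₂ = proj₂ (corner u u∈T)

    pruned⊆ : ∀ {w} → w ∈ prune (region p q) v u → w ∈ region (lab₁ u) (suc (lab₂ u))
    pruned⊆ {w} w∈ with ∈-prune⁻ w∈
    ... | w∈T , w≢u , u≁w , _
      with incomparable⇒crossing (λ cmp → true≢false (comparable⇒adj (≢-sym w≢u) cmp) u≁w)
    ...   | inj₂ (w₁<u₁ , u₂<w₂) = ∈-region⁺ (lab₁ u) (suc (lab₂ u)) (w₁<u₁ , u₂<w₂)
    ...   | inj₁ (u₁<w₁ , w₂<u₂) with adj⇒comparable v~u
    ...     | inj₁ (v₁≤u₁ , _) = contradiction (proj₁ (corner w w∈T)) (ℕₚ.<⇒≱ (ℕₚ.≤-<-trans v₁≤u₁ u₁<w₁))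
    ...     | inj₂ (_ , u₂≤v₂) = contradiction (proj₂ (corner w w∈T)) (ℕₚ.<⇒≱ (ℕₚ.<-≤-trans w₂<u₂ u₂≤v₂))

    ⊆pruned : ∀ {w} → w ∈ region (lab₁ u) (suc (lab₂ u)) → w ∈ prune (region p q) v u
    ⊆pruned {w} w∈ = ∈-prune⁺ (w∈T , (λ { refl → ℕₚ.<-irrefl refl w₁<u₁ }) , u≁w , v≁w)
      where
      w₁<u₁ : lab₁ w < lab₁ u
      w₁<u₁ = proj₁ (∈-region⁻ (lab₁ u) (suc (lab₂ u)) w∈)
      u₂<w₂ : lab₂ u < lab₂ w
      u₂<w₂ = proj₂ (∈-region⁻ (lab₁ u) (suc (lab₂ u)) w∈)
      w∈T : w ∈ region p q
      w∈T = let u₁<p , q≤u₂ = ∈-region⁻ p q u∈T in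
        ∈-region⁺ p q (ℕₚ.<-trans w₁<u₁ u₁<p , ℕₚ.≤-trans q≤u₂ (ℕₚ.<⇒≤ u₂<w₂))
      u≁w : adj G u w ≡ false
      u≁w = incomparable⇒non-adj λ where
        (inj₁ (u₁≤w₁ , _)) → ℕₚ.<⇒≱ w₁<u₁ u₁≤w₁
        (inj₂ (_ , w₂≤u₂)) → ℕₚ.<⇒≱ u₂<w₂ w₂≤u₂
      v≁w : adj G v w ≡ true → u Fin.≤ w
      v≁w v~w with adj⇒comparable v~w
      ... | inj₁ (v₁≤w₁ , _) = contradiction (ℕₚ.≤-trans u₁≤v₁ v₁≤w₁) (ℕₚ.<⇒≱ w₁<u₁)
      ... | inj₂ (_ , w₂≤v₂) = contradiction (ℕₚ.≤-trans w₂≤v₂ v₂≤u₂) (ℕₚ.<⇒≱ u₂<w₂)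

  strategy : Strategy G
  strategy = record
    { Admissible        = λ T → ∃₂ λ p q → p ≤ suc m × T ≡ region p q
    ; choose            = choose
    ; choose-∈          = proj₁ ∘ chosen
    ; choose-simplicial = λ _ eq → corner-simplicial (proj₂ (chosen eq))
    ; choose-exhaustive = exhaustive
    ; admissible-⊤      = suc m , 0 , ℕₚ.≤-refl ,
                          ⊆-antisym (λ {x} _ → ∈-region⁺ (suc m) 0 (Finₚ.toℕ<n (ℓ₁ x) , z≤n)) (λ _ → ∈⊤)
    ; admissible-prune  = λ { {u = u} (p , q , _ , refl) eq u∈T v~u →
        lab₁ u , suc (lab₂ u) , ℕₚ.<⇒≤ (Finₚ.toℕ<n (ℓ₁ u)) , prune-corner p q (proj₂ (chosen eq)) u∈T v~u }
    }
    where
    exhaustive : ∀ {T} → (∃₂ λ p q → p ≤ suc m × T ≡ region p q) → choose T ≡ nothing → ∀ x → x ∉ T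
    exhaustive (p , q , p≤ , refl) eq x x∈ with subst (Least _) eq (choose-spec (region p q))
    ... | none ¬chosen = let w , chosen-w = corner-exists p q p≤ x∈ in ¬chosen w chosen-w

-- Chordal graphs

module Walks (G : Graph) where

  open GraphFacts G

  private
    V : Set
    V = Fin (size G)

  -- Only the positions 0 … len of at are meaningful.
  record Walk (I : Pred V 0ℓ) (x y : V) : Set where
    field
      len   : ℕ
      at    : ℕ → V
      start : at 0 ≡ x
      end   : at len ≡ y
      step  : ∀ {t} → t < len → adj G (at t) (at (suc t)) ≡ true
      inner : ∀ {t} → 0 < t → t < len → I (at t)

  open Walk public

  module _ {I : Pred V 0ℓ} where

    edge : ∀ {x y} → adj G x y ≡ true → Walk I x y
    edge {x} {y} x~y = record
      { len   = 1
      ; at    = λ { zero → x ; (suc _) → y }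
      ; start = refl
      ; end   = refl
      ; step  = λ { (s≤s z≤n) → x~y }
      ; inner = λ { {suc _} _ (s≤s ()) }
      }

    infixr 5 _◅⟨_⟩_
    _◅⟨_⟩_ : ∀ {x w y} → adj G x w ≡ true → I w → Walk I w y → Walk I x y
    _◅⟨_⟩_ {x} x~w Iw walk = record
      { len   = suc (len walk)
      ; at    = λ { zero → x ; (suc t) → at walk t }
      ; start = refl
      ; end   = end walk
      ; step  = λ { {zero} _ → subst (λ z → adj G x z ≡ true) (sym (start walk)) x~w
                  ; {suc t} (s≤s t<) → step walk t< }
      ; inner = λ { {suc zero} _ _ → subst I (sym (start walk)) Iw
                  ; {suc (suc t)} _ (s≤s t<) → inner walk (s≤s z≤n) t< }
      }

    truncate : ∀ {x y} (w : Walk I x y) {t} → t < len w → at w t ≡ y → Walk I x y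
    truncate w {t} t<L at-t≡y = record
      { len   = t
      ; at    = at w
      ; start = start w
      ; end   = at-t≡y
      ; step  = λ k<t → step w (ℕₚ.<-trans k<t t<L)
      ; inner = λ 0<k k<t → inner w 0<k (ℕₚ.<-trans k<t t<L)
      }

    skip : ∀ {x y} (w : Walk I x y) {t u} → t < u → u < len w →
           adj G (at w t) (at w (suc u)) ≡ true → Walk I x y
    skip w {t} {u} t<u u<L t~u+1 = record
      { len   = len w ∸ d
      ; at    = at w ∘ jump
      ; start = trans (cong (at w) (jump-≤ z≤n)) (start w)
      ; end   = trans (cong (at w) (jump-> t<L′)) (trans (cong (at w) L′+d≡L) (end w))
      ; step  = step′
      ; inner = inner′
      }
      where
      d : ℕ
      d = u ∸ t
      t+d≡u : t + d ≡ u
      t+d≡u = ℕₚ.m+[n∸m]≡n (ℕₚ.<⇒≤ t<u)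
      L′+d≡L : len w ∸ d + d ≡ len w
      L′+d≡L = ℕₚ.m∸n+n≡m (ℕₚ.≤-trans (ℕₚ.m∸n≤m u t) (ℕₚ.<⇒≤ u<L))
      <L′⇒+d<L : ∀ {k} → k < len w ∸ d → k + d < len w
      <L′⇒+d<L {k} k<L′ = subst (k + d <_) L′+d≡L (ℕₚ.+-monoˡ-< d k<L′)
      t<L′ : t < len w ∸ d
      t<L′ = ℕₚ.+-cancelʳ-< d t (len w ∸ d) (subst₂ _<_ (sym t+d≡u) (sym L′+d≡L) u<L)
      jump : ℕ → ℕ
      jump k with k ≤? t
      ... | yes _ = k
      ... | no  _ = k + d
      jump-≤ : ∀ {k} → k ≤ t → jump k ≡ k
      jump-≤ {k} k≤t with k ≤? t
      ... | yes _   = refl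
      ... | no  k≰t = contradiction k≤t k≰t
      jump-> : ∀ {k} → t < k → jump k ≡ k + d
      jump-> {k} t<k with k ≤? t
      ... | yes k≤t = contradiction k≤t (ℕₚ.<⇒≱ t<k)
      ... | no  _   = refl
      step′ : ∀ {k} → k < len w ∸ d → adj G (at w (jump k)) (at w (jump (suc k))) ≡ true
      step′ {k} k<L′ with ℕₚ.<-cmp k t
      ... | tri< k<t _ _ rewrite jump-≤ (ℕₚ.<⇒≤ k<t) | jump-≤ k<t =
        step w (ℕₚ.<-trans k<t (ℕₚ.<-trans t<u u<L))
      ... | tri≈ _ refl _ rewrite jump-≤ (ℕₚ.≤-refl {k}) | jump-> (ℕₚ.n<1+n k) | t+d≡u = t~u+1
      ... | tri> _ _ t<k rewrite jump-> t<k | jump-> (ℕₚ.m<n⇒m<1+n t<k) = step w (<L′⇒+d<L k<L′)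
      inner′ : ∀ {k} → 0 < k → k < len w ∸ d → I (at w (jump k))
      inner′ {k} 0<k k<L′ with k ≤? t
      ... | yes k≤t = inner w 0<k (ℕₚ.≤-<-trans k≤t (ℕₚ.<-trans t<u u<L))
      ... | no  _   = inner w (ℕₚ.<-≤-trans 0<k (ℕₚ.m≤m+n k d)) (<L′⇒+d<L k<L′)

    Chordless : ∀ {x y} → Walk I x y → Set
    Chordless w = ∀ {t s} → suc t < s → s ≤ len w → adj G (at w t) (at w s) ≡ false × at w t ≢ at w s

    Shortcut : ∀ {x y} → Walk I x y → ℕ → ℕ → Set
    Shortcut w t s = suc t < s × (adj G (at w t) (at w s) ≡ true ⊎ at w t ≡ at w s)

    private
      shorter : ∀ {d L k} → 0 < d → d ≤ L → L ≤ suc k → L ∸ d ≤ k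
      shorter 0<d d≤L L≤1+k = ℕₚ.≤-pred (ℕₚ.<-≤-trans (ℕₚ.∸-monoʳ-< 0<d d≤L) L≤1+k)

    HasShortcut : ∀ {x y} → Walk I x y → Set
    HasShortcut w = ∃ λ s → s < suc (len w) × ∃ λ t → t < s × Shortcut w t s

    shortcut? : ∀ {x y} (w : Walk I x y) → Dec (HasShortcut w)
    shortcut? w = ℕₚ.anyUpTo? (λ s → ℕₚ.anyUpTo? (λ t → shortcut-at? t s) s) (suc (len w))
      where
      shortcut-at? : ∀ t s → Dec (Shortcut w t s)
      shortcut-at? t s =
        suc t <? s ×-dec (adj G (at w t) (at w s) Bool.≟ true ⊎-dec at w t Finₚ.≟ at w s)

    no-shortcut⇒chordless : ∀ {x y} (w : Walk I x y) → ¬ HasShortcut w → Chordless w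
    no-shortcut⇒chordless w ∄shortcut {t} {s} t+1<s s≤L = ¬-not (no-shortcut ∘ inj₁) , no-shortcut ∘ inj₂
      where
      no-shortcut : ¬ (adj G (at w t) (at w s) ≡ true ⊎ at w t ≡ at w s)
      no-shortcut sc = ∄shortcut (s , s≤s s≤L , t , ℕₚ.<-trans (ℕₚ.n<1+n t) t+1<s , t+1<s , sc)

    chordless-walk : ∀ {x y} k (w : Walk I x y) → len w ≤ k → ∃ (Chordless {x} {y})
    chordless-walk zero w L≤0 = w , λ t+1<s s≤L →
      contradiction (ℕₚ.<-≤-trans (ℕₚ.≤-<-trans z≤n t+1<s) (ℕₚ.≤-trans s≤L L≤0)) ℕₚ.n≮0
    chordless-walk (suc k) w L≤1+k with shortcut? w
    ... | no ∄shortcut = w , no-shortcut⇒chordless w ∄shortcut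
    ... | yes (suc u , s≤s u<L , t , _ , s≤s t<u , inj₁ chord) =
      chordless-walk k (skip w t<u u<L chord)
        (shorter (ℕₚ.m<n⇒0<n∸m t<u) (ℕₚ.≤-trans (ℕₚ.m∸n≤m u t) (ℕₚ.<⇒≤ u<L)) L≤1+k)
    ... | yes (s , s≤s s≤L , t , t<s , _ , inj₂ same) with ℕₚ.m≤n⇒m<n∨m≡n s≤L
    ...   | inj₁ s<L =
      chordless-walk k (skip w t<s s<L (subst (λ z → adj G z (at w (suc s)) ≡ true) (sym same) (step w s<L)))
        (shorter (ℕₚ.m<n⇒0<n∸m t<s) (ℕₚ.≤-trans (ℕₚ.m∸n≤m s t) s≤L) L≤1+k)
    ...   | inj₂ refl = chordless-walk k (truncate w (ℕₚ.<-≤-trans t<s s≤L) (trans same (end w)))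
                          (ℕₚ.≤-pred (ℕₚ.<-≤-trans t<s L≤1+k))

  module Hole {I : Pred V 0ℓ} {x y a : V} (w : Walk I x y) (w-chordless : Chordless w)
              (a~x : adj G a x ≡ true) (a~y : adj G a y ≡ true)
              (far : ∀ {z} → I z → z ≢ a × adj G a z ≡ false) where

    private
      L : ℕ
      L = len w

      ≤L : (i : Fin (suc L)) → toℕ i ≤ L
      ≤L i = ℕₚ.≤-pred (Finₚ.toℕ<n i)

    path-adj⁺ : ∀ {t s} → suc t ≡ s → s ≤ L → adj G (at w t) (at w s) ≡ true
    path-adj⁺ refl s≤L = step w s≤L

    path-adj⁻ : ∀ {t s} → t ≤ L → s ≤ L → adj G (at w t) (at w s) ≡ true → suc t ≡ s ⊎ suc s ≡ t
    path-adj⁻ {t} {s} t≤L s≤L t~s with ℕₚ.<-cmp t s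
    ... | tri≈ _ refl _ = contradiction refl (adj⇒≢ t~s)
    ... | tri< t<s _ _ with ℕₚ.m≤n⇒m<n∨m≡n t<s
    ...   | inj₂ t+1≡s = inj₁ t+1≡s
    ...   | inj₁ t+1<s = contradiction (proj₁ (w-chordless t+1<s s≤L)) (true≢false t~s)
    path-adj⁻ {t} {s} t≤L s≤L t~s | tri> _ _ s<t with ℕₚ.m≤n⇒m<n∨m≡n s<t
    ...   | inj₂ s+1≡t = inj₂ s+1≡t
    ...   | inj₁ s+1<t =
      contradiction (proj₁ (w-chordless s+1<t t≤L)) (true≢false (trans (adj-sym G _ _) t~s))

    path-injective : ∀ {t s} → t ≤ L → s ≤ L → at w t ≡ at w s → t ≡ s
    path-injective {t} {s} t≤L s≤L eq with ℕₚ.<-cmp t s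
    ... | tri≈ _ t≡s _ = t≡s
    ... | tri< t<s _ _ with ℕₚ.m≤n⇒m<n∨m≡n t<s
    ...   | inj₂ refl    = contradiction eq (adj⇒≢ (step w s≤L))
    ...   | inj₁ t+1<s   = contradiction eq (proj₂ (w-chordless t+1<s s≤L))
    path-injective {t} {s} t≤L s≤L eq | tri> _ _ s<t with ℕₚ.m≤n⇒m<n∨m≡n s<t
    ...   | inj₂ refl    = contradiction (sym eq) (adj⇒≢ (step w t≤L))
    ...   | inj₁ s+1<t   = contradiction (sym eq) (proj₂ (w-chordless s+1<t t≤L))

    apex-adj⁺ : ∀ {t} → t ≡ 0 ⊎ t ≡ L → adj G a (at w t) ≡ true
    apex-adj⁺ (inj₁ refl) = subst (λ z → adj G a z ≡ true) (sym (start w)) a~x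
    apex-adj⁺ (inj₂ refl) = subst (λ z → adj G a z ≡ true) (sym (end w)) a~y

    apex-adj⁻ : ∀ {t} → t ≤ L → adj G a (at w t) ≡ true → t ≡ 0 ⊎ t ≡ L
    apex-adj⁻ {zero}  _   _   = inj₁ refl
    apex-adj⁻ {suc t} t≤L a~t with ℕₚ.m≤n⇒m<n∨m≡n t≤L
    ... | inj₂ t≡L = inj₂ t≡L
    ... | inj₁ t<L = contradiction (proj₂ (far (inner w (s≤s z≤n) t<L))) (true≢false a~t)

    apex-fresh : ∀ {t} → t ≤ L → at w t ≢ a
    apex-fresh {zero}  _   at≡a = adj⇒≢ a~x (trans (sym at≡a) (start w))
    apex-fresh {suc t} t≤L at≡a with ℕₚ.m≤n⇒m<n∨m≡n t≤L
    ... | inj₂ refl = adj⇒≢ a~y (trans (sym at≡a) (end w))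
    ... | inj₁ t<L  = proj₁ (far (inner w (s≤s z≤n) t<L)) at≡a

    cycle : Fin (suc (suc L)) → V
    cycle zero    = a
    cycle (suc i) = at w (toℕ i)

    cycle-injective : ∀ {i j} → cycle i ≡ cycle j → i ≡ j
    cycle-injective {zero}  {zero}  _  = refl
    cycle-injective {zero}  {suc j} eq = contradiction (sym eq) (apex-fresh (≤L j))
    cycle-injective {suc i} {zero}  eq = contradiction eq (apex-fresh (≤L i))
    cycle-injective {suc i} {suc j} eq = cong suc (Finₚ.toℕ-injective (path-injective (≤L i) (≤L j) eq))

    cycle-adj⁻ : ∀ i j → adj G (cycle i) (cycle j) ≡ true → CycAdj (suc (suc L)) i j
    cycle-adj⁻ zero    zero    a~a = contradiction (adj-irrefl G a) (true≢false a~a)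
    cycle-adj⁻ zero    (suc j) a~j with apex-adj⁻ (≤L j) a~j
    ... | inj₁ j≡0 = inj₁ (cong suc (sym j≡0))
    ... | inj₂ j≡L = inj₂ (inj₂ (inj₁ (refl , cong (2 +_) j≡L)))
    cycle-adj⁻ (suc i) zero    i~a with apex-adj⁻ (≤L i) (trans (adj-sym G a _) i~a)
    ... | inj₁ i≡0 = inj₂ (inj₁ (cong suc (sym i≡0)))
    ... | inj₂ i≡L = inj₂ (inj₂ (inj₂ (refl , cong (2 +_) i≡L)))
    cycle-adj⁻ (suc i) (suc j) i~j with path-adj⁻ (≤L i) (≤L j) i~j
    ... | inj₁ i+1≡j = inj₁ (cong suc i+1≡j)
    ... | inj₂ j+1≡i = inj₂ (inj₁ (cong suc j+1≡i))

    cycle-adj⁺ : ∀ i j → CycAdj (suc (suc L)) i j → adj G (cycle i) (cycle j) ≡ true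
    cycle-adj⁺ zero    zero    (inj₂ (inj₂ (inj₁ (_ , ()))))
    cycle-adj⁺ zero    zero    (inj₂ (inj₂ (inj₂ (_ , ()))))
    cycle-adj⁺ zero    (suc j) (inj₁ 1≡1+j) = apex-adj⁺ (inj₁ (sym (ℕₚ.suc-injective 1≡1+j)))
    cycle-adj⁺ zero    (suc j) (inj₂ (inj₂ (inj₁ (_ , e)))) =
      apex-adj⁺ (inj₂ (ℕₚ.suc-injective (ℕₚ.suc-injective e)))
    cycle-adj⁺ (suc i) zero    (inj₂ (inj₁ 1≡1+i)) =
      trans (adj-sym G _ a) (apex-adj⁺ (inj₁ (sym (ℕₚ.suc-injective 1≡1+i))))
    cycle-adj⁺ (suc i) zero    (inj₂ (inj₂ (inj₂ (_ , e)))) =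
      trans (adj-sym G _ a) (apex-adj⁺ (inj₂ (ℕₚ.suc-injective (ℕₚ.suc-injective e))))
    cycle-adj⁺ (suc i) (suc j) (inj₁ e)        = path-adj⁺ (ℕₚ.suc-injective e) (≤L j)
    cycle-adj⁺ (suc i) (suc j) (inj₂ (inj₁ e)) = trans (adj-sym G _ _) (path-adj⁺ (ℕₚ.suc-injective e) (≤L i))
    cycle-adj⁺ (suc i) (suc j) (inj₂ (inj₂ (inj₁ (() , _))))
    cycle-adj⁺ (suc i) (suc j) (inj₂ (inj₂ (inj₂ (() , _))))

    hole : IsInducedCycle G (suc (suc L)) cycle
    hole = cycle-injective , λ i j → cycle-adj⁻ i j , cycle-adj⁺ i j

module Components (G : Graph) (R : Subset (size G)) (b : Fin (size G)) (b∈R : b ∈ R) where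

  open Walks G

  private
    V : Set
    V = Fin (size G)
    VSet : Set
    VSet = Subset (size G)

  Joins : VSet → Pred V 0ℓ
  Joins X y = y ∈ R × ∃ λ x → x ∈ X × adj G y x ≡ true

  joins? : ∀ X → Decidable (Joins X)
  joins? X y = y ∈? R ×-dec Finₚ.any? λ x → x ∈? X ×-dec adj G y x Bool.≟ true

  grow : VSet → VSet
  grow X = X ∪ ⟦ joins? X ⟧

  ∈-grow⁻ : ∀ {X y} → y ∈ grow X → y ∈ X ⊎ Joins X y
  ∈-grow⁻ {X} y∈ with x∈p∪q⁻ X _ y∈
  ... | inj₁ y∈X = inj₁ y∈X
  ... | inj₂ y∈new = inj₂ (∈⟦⟧⁻ {P? = joins? X} y∈new)

  ∈-grow⁺ : ∀ {X x y} → y ∈ R → x ∈ X → adj G y x ≡ true → y ∈ grow X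
  ∈-grow⁺ {X} y∈R x∈X y~x = x∈p∪q⁺ (inj₂ (∈⟦⟧⁺ {P? = joins? X} (y∈R , _ , x∈X , y~x)))

  component : VSet
  component = fold ⁅ b ⁆ grow (suc (size G))

  b∈component : b ∈ component
  b∈component = go (suc (size G))
    where
    go : ∀ k → b ∈ fold ⁅ b ⁆ grow k
    go zero    = x∈⁅x⁆ b
    go (suc k) = x∈p∪q⁺ (inj₁ (go k))

  component-closed : ∀ {y c} → y ∈ R → c ∈ component → adj G y c ≡ true → y ∈ component
  component-closed y∈R c∈C y~c =
    subst (_ ∈_) (fold-stable grow (λ X → p⊆p∪q _) ⁅ b ⁆) (∈-grow⁺ y∈R c∈C y~c)

  data Chain : V → Set where
    done : Chain b
    link : ∀ {y z} → y ∈ R → adj G y z ≡ true → Chain z → Chain y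

  chain-∈ : ∀ {c} → Chain c → c ∈ R
  chain-∈ done           = b∈R
  chain-∈ (link c∈R _ _) = c∈R

  chain : ∀ {c} → c ∈ component → Chain c
  chain = go (suc (size G))
    where
    go : ∀ k {c} → c ∈ fold ⁅ b ⁆ grow k → Chain c
    go zero    c∈ with x∈⁅y⁆⇒x≡y b c∈
    ... | refl = done
    go (suc k) c∈ with ∈-grow⁻ c∈
    ... | inj₁ c∈X = go k c∈X
    ... | inj₂ (c∈R , x , x∈X , c~x) = link c∈R c~x (go k x∈X)

  prepend : ∀ {c y} → Chain c → Walk (_∈ R) b y → Walk (_∈ R) c y
  prepend done                w = w
  prepend (link _ c~z chain′) w = c~z ◅⟨ chain-∈ chain′ ⟩ prepend chain′ w

  retrace : ∀ {c y} → Chain c → Walk (_∈ R) c y → Walk (_∈ R) b y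
  retrace done                    w = w
  retrace (link c∈R c~z chain′) w = retrace chain′ (trans (adj-sym G _ _) c~z ◅⟨ c∈R ⟩ w)

module Dirac (G : Graph) (chordal : Chordal G) where

  open GraphFacts G
  open Walks G

  private
    V : Set
    V = Fin (size G)
    VSet : Set
    VSet = Subset (size G)

  Clique : VSet → Set
  Clique T = ∀ {a b} → a ∈ T → b ∈ T → a ≢ b → adj G a b ≡ true

  clique⇒simplicial : ∀ {T v} → Clique T → Simplicial T v
  clique⇒simplicial clique a∈T b∈T _ _ = clique a∈T b∈T

  simplicial-lift : ∀ {T T′ v} → (∀ {w} → w ∈ T → adj G v w ≡ true → w ∈ T′) →
                    Simplicial T′ v → Simplicial T v
  simplicial-lift nbhd⊆T′ simplicial a∈T b∈T v~a v~b =
    simplicial (nbhd⊆T′ a∈T v~a) (nbhd⊆T′ b∈T v~b) v~a v~b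

  clique-or-gap : ∀ T → Clique T ⊎ ∃₂ λ a b → a ∈ T × b ∈ T × a ≢ b × adj G a b ≡ false
  clique-or-gap T with Finₚ.any? (λ a → Finₚ.any? λ b →
                         a ∈? T ×-dec b ∈? T ×-dec ¬? (a Finₚ.≟ b) ×-dec adj G a b Bool.≟ false)
  ... | yes (a , b , gap) = inj₂ (a , b , gap)
  ... | no ∄gap = inj₁ λ {a} {b} a∈T b∈T a≢b → ¬-not λ a≁b → ∄gap (a , b , a∈T , b∈T , a≢b , a≁b)

  TwoSimplicial : VSet → Set
  TwoSimplicial T = ∃₂ λ z₁ z₂ → z₁ ∈ T × z₂ ∈ T × z₁ ≢ z₂ × adj G z₁ z₂ ≡ false ×
                                 Simplicial T z₁ × Simplicial T z₂

  walk-long : ∀ {I x y} (w : Walk I x y) → x ≢ y → adj G x y ≡ false → 2 ≤ len w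
  walk-long w x≢y x≁y = go (len w) refl
    where
    go : ∀ n → len w ≡ n → 2 ≤ n
    go zero          refl = contradiction (trans (sym (start w)) (end w)) x≢y
    go (suc zero)    refl = contradiction x≁y
      (true≢false (subst₂ (λ p q → adj G p q ≡ true) (start w) (end w) (step w (s≤s z≤n))))
    go (suc (suc n)) _    = s≤s (s≤s z≤n)

  -- C is the component of b in G[T] − N[a] and S its neighbourhood in T, which lies in N(a).
  -- S is a clique, since for non-adjacent x, y ∈ S a chordless x–y path through C together with a
  -- would form a hole.
  module Split (T : VSet) {a b : V} (a∈T : a ∈ T) (b∈T : b ∈ T) (a≢b : a ≢ b)
               (a≁b : adj G a b ≡ false) where

    Far : Pred V 0ℓ
    Far y = y ∈ T × y ≢ a × adj G a y ≡ false

    far? : Decidable Far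
    far? y = y ∈? T ×-dec ¬? (y Finₚ.≟ a) ×-dec adj G a y Bool.≟ false

    R : VSet
    R = ⟦ far? ⟧

    ∈R⁻ : ∀ {y} → y ∈ R → Far y
    ∈R⁻ = ∈⟦⟧⁻ {P? = far?}

    open Components G R b (∈⟦⟧⁺ {P? = far?} (b∈T , ≢-sym a≢b , a≁b)) public

    C : VSet
    C = component

    Border : Pred V 0ℓ
    Border y = y ∈ T × y ∉ C × ∃ λ c → c ∈ C × adj G y c ≡ true

    border? : Decidable Border
    border? y = y ∈? T ×-dec ¬? (y ∈? C) ×-dec Finₚ.any? λ c → c ∈? C ×-dec adj G y c Bool.≟ true

    S : VSet
    S = ⟦ border? ⟧

    ∈S⁻ : ∀ {y} → y ∈ S → Border y
    ∈S⁻ = ∈⟦⟧⁻ {P? = border?}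

    ∈S⁺ : ∀ {y} → Border y → y ∈ S
    ∈S⁺ = ∈⟦⟧⁺ {P? = border?}

    C-far : ∀ {c} → c ∈ C → Far c
    C-far = ∈R⁻ ∘ chain-∈ ∘ chain

    border-adj : ∀ {y} → y ∈ S → adj G a y ≡ true
    border-adj {y} y∈S with ∈S⁻ y∈S
    ... | y∈T , y∉C , c , c∈C , y~c with y Finₚ.≟ a
    ...   | yes refl = contradiction (proj₂ (proj₂ (C-far c∈C))) (true≢false y~c)
    ...   | no y≢a   = ¬-not λ a≁y →
      y∉C (component-closed (∈⟦⟧⁺ {P? = far?} (y∈T , y≢a , a≁y)) c∈C y~c)

    R-far : ∀ {z} → z ∈ R → z ≢ a × adj G a z ≡ false
    R-far z∈R = proj₂ (∈R⁻ z∈R)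

    detour : ∀ {x y cx cy} → adj G x cx ≡ true → cx ∈ C → adj G y cy ≡ true → cy ∈ C →
             Walk (_∈ R) x y
    detour x~cx cx∈C y~cy cy∈C =
      x~cx ◅⟨ chain-∈ (chain cx∈C) ⟩
      prepend (chain cx∈C) (retrace (chain cy∈C) (edge (trans (adj-sym G _ _) y~cy)))

    S-clique : Clique S
    S-clique {x} {y} x∈S y∈S x≢y with ∈S⁻ x∈S | ∈S⁻ y∈S
    ... | _ , _ , _ , cx∈C , x~cx | _ , _ , _ , cy∈C , y~cy
      with chordless-walk _ (detour x~cx cx∈C y~cy cy∈C) ℕₚ.≤-refl
    ...   | w , w-chordless = ¬-not λ x≁y → chordal _ (s≤s (s≤s (walk-long w x≢y x≁y))) cycle hole
      where open Hole w w-chordless (border-adj x∈S) (border-adj y∈S) R-far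

    Outside : Pred V 0ℓ
    Outside y = y ∈ T × y ∉ C

    T₁ : VSet
    T₁ = ⟦ (λ y → y ∈? T ×-dec ¬? (y ∈? C)) ⟧

    ∈T₁⁻ : ∀ {y} → y ∈ T₁ → Outside y
    ∈T₁⁻ = ∈⟦⟧⁻ {P? = λ y → y ∈? T ×-dec ¬? (y ∈? C)}

    ∈T₁⁺ : ∀ {y} → Outside y → y ∈ T₁
    ∈T₁⁺ = ∈⟦⟧⁺ {P? = λ y → y ∈? T ×-dec ¬? (y ∈? C)}

    T₂ : VSet
    T₂ = C ∪ S

    a∉C : a ∉ C
    a∉C a∈C = proj₁ (proj₂ (C-far a∈C)) refl

    a∉S : a ∉ S
    a∉S a∈S = true≢false (border-adj a∈S) (adj-irrefl G a)

    T₁⊂T : T₁ ⊂ T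
    T₁⊂T = proj₁ ∘ ∈T₁⁻ , b , b∈T , λ b∈T₁ → proj₂ (∈T₁⁻ b∈T₁) b∈component

    T₂⊂T : T₂ ⊂ T
    T₂⊂T = (λ y∈T₂ → [ proj₁ ∘ C-far , proj₁ ∘ ∈S⁻ ] (x∈p∪q⁻ C S y∈T₂)) ,
           a , a∈T , λ a∈T₂ → [ a∉C , a∉S ] (x∈p∪q⁻ C S a∈T₂)

    outer-nbhd : ∀ {z w} → z ∈ T₁ → z ∉ S → w ∈ T → adj G z w ≡ true → w ∈ T₁
    outer-nbhd {z} {w} z∈T₁ z∉S w∈T z~w =
      ∈T₁⁺ (w∈T , λ w∈C → z∉S (∈S⁺ (proj₁ (∈T₁⁻ z∈T₁) , proj₂ (∈T₁⁻ z∈T₁) , w , w∈C , z~w)))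

    inner-nbhd : ∀ {z w} → z ∈ C → w ∈ T → adj G z w ≡ true → w ∈ T₂
    inner-nbhd {z} {w} z∈C w∈T z~w with w ∈? C
    ... | yes w∈C = x∈p∪q⁺ (inj₁ w∈C)
    ... | no  w∉C = x∈p∪q⁺ (inj₂ (∈S⁺ (w∈T , w∉C , z , z∈C , trans (adj-sym G w z) z~w)))

    outer-simplicial : Clique T₁ ⊎ TwoSimplicial T₁ → ∃ λ z → z ∈ T₁ × z ∉ S × Simplicial T₁ z
    outer-simplicial (inj₁ clique) = a , ∈T₁⁺ (a∈T , a∉C) , a∉S , clique⇒simplicial clique
    outer-simplicial (inj₂ (z₁ , z₂ , z₁∈ , z₂∈ , z₁≢z₂ , z₁≁z₂ , simp₁ , simp₂)) with z₁ ∈? S | z₂ ∈? S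
    ... | no z₁∉S  | _        = z₁ , z₁∈ , z₁∉S , simp₁
    ... | yes _    | no z₂∉S  = z₂ , z₂∈ , z₂∉S , simp₂
    ... | yes z₁∈S | yes z₂∈S = contradiction z₁≁z₂ (true≢false (S-clique z₁∈S z₂∈S z₁≢z₂))

    inner-simplicial : Clique T₂ ⊎ TwoSimplicial T₂ → ∃ λ z → z ∈ C × Simplicial T₂ z
    inner-simplicial (inj₁ clique) = b , b∈component , clique⇒simplicial clique
    inner-simplicial (inj₂ (z₁ , z₂ , z₁∈ , z₂∈ , z₁≢z₂ , z₁≁z₂ , simp₁ , simp₂)) with z₁ ∈? S | z₂ ∈? S
    ... | no z₁∉S  | _        = z₁ , [ id , (λ z₁∈S → contradiction z₁∈S z₁∉S) ] (x∈p∪q⁻ C S z₁∈) , simp₁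
    ... | yes _    | no z₂∉S  = z₂ , [ id , (λ z₂∈S → contradiction z₂∈S z₂∉S) ] (x∈p∪q⁻ C S z₂∈) , simp₂
    ... | yes z₁∈S | yes z₂∈S = contradiction z₁≁z₂ (true≢false (S-clique z₁∈S z₂∈S z₁≢z₂))

    split : Clique T₁ ⊎ TwoSimplicial T₁ → Clique T₂ ⊎ TwoSimplicial T₂ → TwoSimplicial T
    split dirac₁ dirac₂ with outer-simplicial dirac₁ | inner-simplicial dirac₂
    ... | z₁ , z₁∈T₁ , z₁∉S , simp₁ | z₂ , z₂∈C , simp₂ =
      z₁ , z₂ , proj₁ (∈T₁⁻ z₁∈T₁) , proj₁ (C-far z₂∈C) , (λ { refl → proj₂ (∈T₁⁻ z₁∈T₁) z₂∈C }) ,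
      ¬-not (λ z₁~z₂ → z₁∉S (∈S⁺ (proj₁ (∈T₁⁻ z₁∈T₁) , proj₂ (∈T₁⁻ z₁∈T₁) , z₂ , z₂∈C , z₁~z₂))) ,
      simplicial-lift (outer-nbhd z₁∈T₁ z₁∉S) simp₁ ,
      simplicial-lift (inner-nbhd z₂∈C) simp₂

  dirac : ∀ k T → ∣ T ∣ ≤ k → Clique T ⊎ TwoSimplicial T
  dirac zero    T ∣T∣≤0 = inj₁ λ a∈T → contradiction a∈T (∣p∣≤0⇒x∉p ∣T∣≤0)
  dirac (suc k) T ∣T∣≤ with clique-or-gap T
  ... | inj₁ clique = inj₁ clique
  ... | inj₂ (a , b , a∈T , b∈T , a≢b , a≁b) =
    inj₂ (split (dirac k T₁ (smaller T₁⊂T)) (dirac k T₂ (smaller T₂⊂T)))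
    where
    open Split T a∈T b∈T a≢b a≁b
    smaller : ∀ {T′} → T′ ⊂ T → ∣ T′ ∣ ≤ k
    smaller T′⊂T = ℕₚ.≤-pred (ℕₚ.<-≤-trans (p⊂q⇒∣p∣<∣q∣ T′⊂T) ∣T∣≤)

  simplicial-exists : ∀ {T x} → x ∈ T → ∃ λ v → v ∈ T × Simplicial T v
  simplicial-exists {T} {x} x∈T with dirac ∣ T ∣ T ℕₚ.≤-refl
  ... | inj₁ clique = x , x∈T , clique⇒simplicial clique
  ... | inj₂ (z , _ , z∈T , _ , _ , _ , simp , _) = z , z∈T , simp

module ChordalStrategy (G : Graph) (chordal : Chordal G) where

  open GraphFacts G
  open Dirac G chordal

  private
    VSet : Set
    VSet = Subset (size G)

  simplicial? : ∀ T v → Dec (Simplicial T v)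
  simplicial? T v = Dec.map′ (λ simp {a} {b} → simp a b) (λ simp a b → simp)
    (Finₚ.all? λ a → Finₚ.all? λ b → a ∈? T →-dec b ∈? T →-dec adj G v a Bool.≟ true →-dec
       adj G v b Bool.≟ true →-dec ¬? (a Finₚ.≟ b) →-dec adj G a b Bool.≟ true)

  Chosen : VSet → Pred (Fin (size G)) 0ℓ
  Chosen T v = v ∈ T × Simplicial T v

  choose : VSet → Maybe (Fin (size G))
  choose T = least λ v → v ∈? T ×-dec simplicial? T v

  chosen : ∀ {T v} → choose T ≡ just v → Chosen T v
  chosen {T} eq with subst (Least (Chosen T)) eq (least-spec _)
  ... | some chosen-v _ = chosen-v

  strategy : Strategy G
  strategy = record
    { Admissible        = λ _ → Unit
    ; choose            = choose
    ; choose-∈          = proj₁ ∘ chosen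
    ; choose-simplicial = λ _ → proj₂ ∘ chosen
    ; choose-exhaustive = exhaustive
    ; admissible-⊤      = tt
    ; admissible-prune  = λ _ _ _ _ → tt
    }
    where
    exhaustive : ∀ {T} → Unit → choose T ≡ nothing → ∀ x → x ∉ T
    exhaustive {T} _ eq x x∈T with subst (Least (Chosen T)) eq (least-spec _)
    ... | none ¬chosen = let v , v∈T , simp = simplicial-exists x∈T in ¬chosen v (v∈T , simp)

theorem1p2 : (G : Graph) → Chordal G ⊎ (Σ ℕ λ m → Σ ℕ λ n → InClassG m n G) →
    Σ (Matching G) λ M → IsAcyclicMatching G M ×
      Σ (Maybe (Fin (size G))) λ w → ∀ σ → Critical G M σ →
        MaximalSimplex G σ ⊎ (∃[ v ] (w ≡ just v × σ ≡ ⁅ v ⁆))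
theorem1p2 G (inj₁ chordal)          = strategy-theorem (ChordalStrategy.strategy G chordal)
theorem1p2 G (inj₂ (m , n , G∈𝒢ₘₙ)) = strategy-theorem (ClassGStrategy.strategy G m n G∈𝒢ₘₙ)
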